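{- Let $j\geq 1$ be fixed and let $$s=\frac{(-3)^{2j+1}+4(2j+1)-1}{8}\in\mathbb{Z}_{<0}.$$ Let $G_0$ be the basket graph $\mathsf{B}_{2j+1}$. For $i\geq 1$, let $G_i$ be obtained from $G_{i-1}$ by adding a pendant vertex (a new vertex joined by a single edge to some vertex of $G_{i-1}$) in any manner. Let $G=G_{2|s|}$ be any graph obtained from this procedure after exactly $2|s|$ steps. Then $G$ is distance exceptional.
   Context: All graphs are finite, simple, undirected. For a connected graph $G$ with vertices $v_1,\dots,v_n$, its distance matrix is $D=(d(v_i,v_j))_{i,j=1}^n$, where $d$ is the shortest-path distance, and $\vec 1$ denotes the all-ones vector. $G$ is called distance exceptional if the equation $D\vec x=\vec 1$ has no solution $\vec x\in\mathbb{R}^n$. For $k\ge 1$, let $\mathsf{P}_m$ denote the path on $m$ vertices; the $k$-th basket graph $\mathsf{B}_k$ is obtained by taking disjoint copies of $\mathsf{P}_k,\mathsf{P}_{k+1},\mathsf{P}_{k+1},\mathsf{P}_{k+1}$ and identifying one endpoint of each of the four paths into a single vertex and the other endpoints of each of the four paths into a second single vertex (creating two vertices of degree four).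
   Formalization: The solutions $\vec x$ of $D\vec x=\vec 1$ are taken in ℚ^n rather than $\mathbb{R}^n$. -}

module Defs where

open import Level using (0ℓ)
open import Data.Nat as ℕ using (ℕ; zero; suc; _≤_; _∸_)
open import Data.Integer as ℤ using (ℤ; +_)
open import Data.Rational as ℚ using (ℚ; 1ℚ; 0ℚ)
open import Data.Fin using (Fin; toℕ; zero; suc)
open import Data.List using (List; []; _∷_; _++_)
open import Data.List.Membership.Propositional using (_∈_)
open import Data.Product using (_×_; _,_; Σ)
open import Data.Sum using (_⊎_)
open import Data.Empty using (⊥)
open import Relation.Binary.PropositionalEquality using (_≡_)
open import Relation.Nullary using (¬_)

Graph : ℕ → Set₁
Graph n = Fin n → Fin n → Set

-- Basket graph B_k on Fin (4k - 3) vertices (for k ≥ 2).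
-- Vertex 0 and vertex 1 are the two degree-four hubs.

-- pathEdges u v s m : edges of a path u - s - (s+1) - ... - (s+m-1) - v
-- with m internal vertices numbered s, ..., s+m-1.
pathEdges : ℕ → ℕ → ℕ → ℕ → List (ℕ × ℕ)
pathEdges u v s zero    = (u , v) ∷ []
pathEdges u v s (suc m) = (u , s) ∷ pathEdges s v (suc s) m

-- P_k   : internal vertices 2 .. k-1          (k-2 of them)
-- P_k+1 : internal vertices k .. 2k-2         (k-1 of them)
-- P_k+1 : internal vertices 2k-1 .. 3k-3      (k-1 of them)
-- P_k+1 : internal vertices 3k-2 .. 4k-4      (k-1 of them)
basketEdges : ℕ → List (ℕ × ℕ)
basketEdges k =
  pathEdges 0 1 2 (k ∸ 2)
  ++ pathEdges 0 1 k (k ∸ 1)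
  ++ pathEdges 0 1 (2 ℕ.* k ∸ 1) (k ∸ 1)
  ++ pathEdges 0 1 (3 ℕ.* k ∸ 2) (k ∸ 1)

basketSize : ℕ → ℕ
basketSize k = 4 ℕ.* k ∸ 3

Basket : (k : ℕ) → Graph (basketSize k)
Basket k a b = ((toℕ a , toℕ b) ∈ basketEdges k) ⊎ ((toℕ b , toℕ a) ∈ basketEdges k)

-- Adding a pendant vertex: the new vertex is 'zero', old vertex a
-- becomes 'suc a', and the new vertex is joined exactly to v.
addPendant : ∀ {n} → Graph n → Fin n → Graph (suc n)
addPendant G v zero    zero    = ⊥
addPendant G v zero    (suc b) = b ≡ v
addPendant G v (suc a) zero    = a ≡ v
addPendant G v (suc a) (suc b) = G a b

data Obtained (k : ℕ) : ℕ → (n : ℕ) → Graph n → Set₁ where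
  base : Obtained k 0 (basketSize k) (Basket k)
  step : ∀ {i n G} → Obtained k i n G → (v : Fin n) →
         Obtained k (suc i) (suc n) (addPendant G v)

data Walk {n} (G : Graph n) : Fin n → Fin n → ℕ → Set where
  nil  : ∀ {u} → Walk G u u 0
  cons : ∀ {u w v m} → G u w → Walk G w v m → Walk G u v (suc m)

IsDistance : ∀ {n} → Graph n → Fin n → Fin n → ℕ → Set
IsDistance G u v k = Walk G u v k × (∀ m → Walk G u v m → k ≤ m)

IsDistanceMatrix : ∀ {n} → Graph n → (Fin n → Fin n → ℕ) → Set
IsDistanceMatrix G D = ∀ u v → IsDistance G u v (D u v)

Connected : ∀ {n} → Graph n → Set
Connected G = ∀ u v → Σ ℕ (λ k → Walk G u v k)

sumFin : ∀ {n} → (Fin n → ℚ) → ℚ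
sumFin {zero}  f = 0ℚ
sumFin {suc n} f = f zero ℚ.+ sumFin (λ i → f (suc i))

ℕtoℚ : ℕ → ℚ
ℕtoℚ m = (+ m) ℚ./ 1

DistanceExceptional : ∀ {n} → Graph n → Set
DistanceExceptional {n} G =
  ∀ (D : Fin n → Fin n → ℕ) → IsDistanceMatrix G D →
  ¬ Σ (Fin n → ℚ) (λ x → ∀ i → sumFin (λ j → ℕtoℚ (D i j) ℚ.* x j) ≡ 1ℚ)

sVal : ℕ → ℤ
sVal j = ((((ℤ.- (+ 3)) ℤ.^ (2 ℕ.* j ℕ.+ 1)) ℤ.+ (+ (4 ℕ.* (2 ℕ.* j ℕ.+ 1)))) ℤ.- (+ 1)) ℤ./ (+ 8)

private
  open import Relation.Binary.PropositionalEquality using (refl)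
  _ : sVal 1 ≡ ℤ.- (+ 2)
  _ = refl
  _ : sVal 2 ≡ ℤ.- (+ 28)
  _ = refl

{-# OPTIONS --safe #-}
-- Call an integer vector y a certificate of value a for G if Σ y = 2 and every
-- column of yᵀD equals a.  A certificate of value 0 rules out D x = 1, since
-- pairing with y gives yᵀ(D x) = 0 but yᵀ1 = 2.  Hanging a pendant vertex on v
-- turns a certificate of value a into one of value a + 1: the new vertex gets
-- weight 1 and v loses 1.  On the basket with short path of length N and three
-- long paths of length N + 1, the weight (-3)^d(v,hub₁) + (-3)^d(v,hub₀) (both
-- distances lowered by one on the long paths) is a certificate: along every path
-- the column sums have vanishing first and second differences, because the
-- second differences of distances only see the vertex itself and the antipodal
-- vertices on the other paths, and -3 is the root of the resulting recurrence.
-- Its value N + 3 Σ_{t<N} (-3)^t equals 2 s for N = 2 j, so 2 |s| pendant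
-- vertices bring it to 0.
module Submission where

open import Defs
open import Data.Nat as ℕ using (ℕ; zero; suc; _+_; _*_; _∸_; _⊓_; ∣_-_∣; _≤_; _<_; _<?_; z≤n; s≤s)
import Data.Nat.Properties as ℕP
import Data.Nat.DivMod as ℕD
import Data.Nat.Tactic.RingSolver as ℕSolver
open import Data.Integer as ℤ using (ℤ; +_; -[1+_]; ∣_∣)
import Data.Integer.Properties as ℤP
open import Data.Integer.Tactic.RingSolver using (solve-∀)
open import Data.Rational as ℚ using (ℚ; 0ℚ)
import Data.Rational.Properties as ℚP
import Data.Rational.Unnormalised as ℚᵘ
import Data.Rational.Unnormalised.Properties as ℚᵘP
open import Data.Fin using (Fin; zero; suc; toℕ; fromℕ<)
import Data.Fin.Properties as FinP
open import Data.Bool using (if_then_else_)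
open import Data.List using (List; []; _∷_)
open import Data.List.Membership.Propositional using (_∈_)
open import Data.List.Membership.Propositional.Properties using (∈-++⁺ˡ; ∈-++⁺ʳ; ∈-++⁻)
open import Data.List.Relation.Unary.All using (All; []; _∷_)
open import Data.List.Relation.Unary.Any using (here; there)
open import Data.Product using (∃; ∃₂; _×_; _,_; proj₁; proj₂)
open import Data.Sum using (inj₁; inj₂; swap)
open import Function using (_∘_)
open import Relation.Binary.Definitions using (DecidableEquality)
open import Relation.Binary.PropositionalEquality
open import Relation.Nullary using (does; yes; no)
open import Relation.Nullary.Decidable using (dec-true; dec-false; map′)
open import Algebra.Bundles using (Ring)
open import Algebra.Properties.Semiring.Sum ℤP.+-*-semiring
import Algebra.Properties.Semiring.Sum (Ring.semiring ℚP.+-*-ring) as ℚΣ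

module _ {n} {G : Graph n} where

  _++ʷ_ : ∀ {u v w k l} → Walk G u v k → Walk G v w l → Walk G u w (k + l)
  nil      ++ʷ q = q
  cons e p ++ʷ q = cons e (p ++ʷ q)

  walk-reverse : (∀ {a b} → G a b → G b a) → ∀ {u v k} → Walk G u v k → Walk G v u k
  walk-reverse G-sym nil        = nil
  walk-reverse G-sym (cons e p) = subst (Walk G _ _) (ℕP.+-comm _ 1) (walk-reverse G-sym p ++ʷ cons (G-sym e) nil)

  IsDistance-unique : ∀ {u v a b} → IsDistance G u v a → IsDistance G u v b → a ≡ b
  IsDistance-unique (p , p-min) (q , q-min) = ℕP.≤-antisym (p-min _ q) (q-min _ p)

  potential-≤-length : (f : Fin n → ℕ) → (∀ {a b} → G a b → f a ≤ suc (f b)) →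
                       ∀ {u v k} → Walk G u v k → f u ≤ k + f v
  potential-≤-length f f-step nil        = ℕP.≤-refl
  potential-≤-length f f-step (cons e p) = ℕP.≤-trans (f-step e) (s≤s (potential-≤-length f f-step p))

  IsDistance-by-potential : ∀ {u v k} (f : Fin n → ℕ) → (∀ {a b} → G a b → f a ≤ suc (f b)) →
                            f u ≡ k → f v ≡ 0 → Walk G u v k → IsDistance G u v k
  IsDistance-by-potential f f-step fu≡k fv≡0 p = p , λ m q →
    subst₂ _≤_ fu≡k (trans (cong (_+_ m) fv≡0) (ℕP.+-identityʳ m)) (potential-≤-length f f-step q)

  distance-refl : ∀ {D} → IsDistanceMatrix G D → ∀ u → D u u ≡ 0
  distance-refl isD u = ℕP.n≤0⇒n≡0 (proj₂ (isD u u) 0 nil)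

module Pendant {n} (G : Graph n) (v : Fin n) where

  G⁺ : Graph (suc n)
  G⁺ = addPendant G v

  lift : ∀ {a b k} → Walk G a b k → Walk G⁺ (suc a) (suc b) k
  lift nil        = nil
  lift (cons e p) = cons e (lift p)

  -- A detour v → pendant → v can be cut out.
  unlift : ∀ {a b k} → Walk G⁺ (suc a) (suc b) k → ∃ λ l → l ≤ k × Walk G a b l
  unlift nil = 0 , z≤n , nil
  unlift (cons {w = suc _} e p) with unlift p
  ... | l , l≤k , q = suc l , s≤s l≤k , cons e q
  unlift (cons {w = zero} refl (cons {w = suc _} refl p)) with unlift p
  ... | l , l≤k , q = l , ℕP.m≤n⇒m≤o+n 2 l≤k , q

  unlift-to-pendant : ∀ {a k} → Walk G⁺ (suc a) zero k → ∃ λ l → suc l ≤ k × Walk G a v l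
  unlift-to-pendant (cons {w = zero} refl nil) = 0 , s≤s z≤n , nil
  unlift-to-pendant (cons {w = zero} refl (cons {w = suc _} refl p)) with unlift-to-pendant p
  ... | l , l<k , q = l , ℕP.m≤n⇒m≤o+n 2 l<k , q
  unlift-to-pendant (cons {w = suc _} e p) with unlift-to-pendant p
  ... | l , l<k , q = suc l , s≤s l<k , cons e q

  module _ {D⁺ : Fin (suc n) → Fin (suc n) → ℕ} (isD⁺ : IsDistanceMatrix G⁺ D⁺) where

    D : Fin n → Fin n → ℕ
    D a b = D⁺ (suc a) (suc b)

    D-isDistanceMatrix : IsDistanceMatrix G D
    D-isDistanceMatrix a b with unlift (proj₁ (isD⁺ (suc a) (suc b)))
    ... | l , l≤D , p = subst (Walk G a b) (ℕP.≤-antisym l≤D (proj₂ (isD⁺ _ _) l (lift p))) p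
                      , λ m q → proj₂ (isD⁺ _ _) m (lift q)

    D⁺-from-pendant : ∀ b → D⁺ zero (suc b) ≡ suc (D v b)
    D⁺-from-pendant b = IsDistance-unique (isD⁺ zero (suc b)) (cons refl (lift p) , minimal)
      where
      p = proj₁ (D-isDistanceMatrix v b)
      minimal : ∀ m → Walk G⁺ zero (suc b) m → suc (D v b) ≤ m
      minimal _ (cons {w = suc _} refl q) with unlift q
      ... | l , l≤m , q′ = s≤s (ℕP.≤-trans (proj₂ (D-isDistanceMatrix v b) l q′) l≤m)

    D⁺-to-pendant : ∀ a → D⁺ (suc a) zero ≡ suc (D a v)
    D⁺-to-pendant a = IsDistance-unique (isD⁺ (suc a) zero) (walk , minimal)
      where
      walk : Walk G⁺ (suc a) zero (suc (D a v))
      walk = subst (Walk G⁺ (suc a) zero) (ℕP.+-comm (D a v) 1)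
                   (lift (proj₁ (D-isDistanceMatrix a v)) ++ʷ cons refl nil)
      minimal : ∀ m → Walk G⁺ (suc a) zero m → suc (D a v) ≤ m
      minimal m q with unlift-to-pendant q
      ... | l , l<m , q′ = ℕP.≤-trans (s≤s (proj₂ (D-isDistanceMatrix a v) l q′)) l<m

δ : ℕ → ℕ → ℤ
δ m n = if does (m ℕ.≟ n) then + 1 else + 0

δ-≢ : ∀ {m n} → m ≢ n → δ m n ≡ + 0
δ-≢ {m} {n} m≢n rewrite dec-false (m ℕ.≟ n) m≢n = refl

∑-δ : ∀ {n} (f : Fin n → ℤ) (v : Fin n) → ∑[ i < n ] (δ (toℕ i) (toℕ v) ℤ.* f i) ≡ f v
∑-δ {suc n} f zero = begin
  + 1 ℤ.* f zero ℤ.+ ∑[ i < n ] (+ 0 ℤ.* f (suc i)) ≡⟨ cong₂ ℤ._+_ (ℤP.*-identityˡ (f zero)) (sum-cong-≗ (λ i → ℤP.*-zeroˡ (f (suc i)))) ⟩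
  f zero ℤ.+ ∑[ i < n ] (+ 0)                        ≡⟨ cong (ℤ._+_ (f zero)) (sum-replicate-zero n) ⟩
  f zero ℤ.+ + 0                                    ≡⟨ ℤP.+-identityʳ (f zero) ⟩
  f zero ∎
  where open ≡-Reasoning
∑-δ f (suc v) = trans (ℤP.+-identityˡ _) (∑-δ (λ i → f (suc i)) v)

δ-≡ : ∀ {m n} → m ≡ n → δ m n ≡ + 1
δ-≡ {m} refl rewrite dec-true (m ℕ.≟ m) refl = refl

δ-iff : ∀ {a b c d} → (a ≡ b → c ≡ d) → (c ≡ d → a ≡ b) → δ a b ≡ δ c d
δ-iff {a} {b} to from with a ℕ.≟ b
... | yes a≡b = trans (δ-≡ a≡b) (sym (δ-≡ (to a≡b)))
... | no  a≢b = trans (δ-≢ a≢b) (sym (δ-≢ (λ c≡d → a≢b (from c≡d))))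

δ-+ˡ : ∀ k m n → δ (k + m) (k + n) ≡ δ m n
δ-+ˡ k m n = δ-iff (ℕP.+-cancelˡ-≡ k m n) (cong (_+_ k))

double-injective : ∀ a b → a + a ≡ b + b → a ≡ b
double-injective zero    zero    _  = refl
double-injective (suc a) (suc b) eq =
  cong suc (double-injective a b (ℕP.suc-injective (trans (sym (ℕP.+-suc a a)) (trans (ℕP.suc-injective eq) (ℕP.+-suc b b)))))

double≢odd : ∀ a b → a + a ≢ suc (b + b)
double≢odd (suc a) zero    eq = case (trans (sym (ℕP.+-suc a a)) (ℕP.suc-injective eq))
  where
  case : suc (a + a) ≢ 0
  case ()
double≢odd (suc a) (suc b) eq =
  double≢odd a b (ℕP.suc-injective (trans (sym (ℕP.+-suc a a)) (trans (ℕP.suc-injective eq) (cong suc (ℕP.+-suc b b)))))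

δ-double : ∀ a b → δ (a + a) (b + b) ≡ δ a b
δ-double a b = δ-iff (double-injective a b) (cong (λ c → c + c))

δ-double-odd : ∀ a b → δ (a + a) (suc (b + b)) ≡ + 0
δ-double-odd a b = δ-≢ (double≢odd a b)

δ-odd-double : ∀ a b → δ (suc (a + a)) (b + b) ≡ + 0
δ-odd-double a b = δ-≢ (λ eq → double≢odd b a (sym eq))

-- Distance certificates

-- The normalisation 2 of the total weight is what makes a pendant vertex raise
-- the common column sum by exactly one.
record Certificate {n} (G : Graph n) (a : ℤ) : Set where
  field
    weight     : Fin n → ℤ
    weight-sum : ∑[ i < n ] weight i ≡ + 2
    column-sum : ∀ {D} → IsDistanceMatrix G D → ∀ c → ∑[ i < n ] (weight i ℤ.* + D i c) ≡ a

Certificate-addPendant : ∀ {n} {G : Graph n} {a} → Certificate G a → ∀ v → Certificate (addPendant G v) (a ℤ.+ + 1)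
Certificate-addPendant {n} {G} {a} C v = record
  { weight = weight⁺ ; weight-sum = weight⁺-sum ; column-sum = column-sum⁺ }
  where
  open Certificate C
  open Pendant G v

  weight⁺ : Fin (suc n) → ℤ
  weight⁺ zero    = + 1
  weight⁺ (suc i) = weight i ℤ.- δ (toℕ i) (toℕ v)

  shifted-sum : ∀ f → ∑[ i < n ] (weight⁺ (suc i) ℤ.* f i) ≡ ∑[ i < n ] (weight i ℤ.* f i) ℤ.- f v
  shifted-sum f = begin
    ∑[ i < n ] ((weight i ℤ.- δ (toℕ i) (toℕ v)) ℤ.* f i)
      ≡⟨ sum-cong-≗ (λ i → distrib (weight i) (δ (toℕ i) (toℕ v)) (f i)) ⟩
    ∑[ i < n ] (weight i ℤ.* f i ℤ.+ ℤ.-1ℤ ℤ.* (δ (toℕ i) (toℕ v) ℤ.* f i))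
      ≡⟨ ∑-distrib-+ (λ i → weight i ℤ.* f i) (λ i → ℤ.-1ℤ ℤ.* (δ (toℕ i) (toℕ v) ℤ.* f i)) ⟩
    ∑[ i < n ] (weight i ℤ.* f i) ℤ.+ ∑[ i < n ] (ℤ.-1ℤ ℤ.* (δ (toℕ i) (toℕ v) ℤ.* f i))
      ≡⟨ cong (ℤ._+_ (∑[ i < n ] (weight i ℤ.* f i)))
              (trans (sym (*-distribˡ-sum ℤ.-1ℤ (λ i → δ (toℕ i) (toℕ v) ℤ.* f i))) (cong (ℤ.-1ℤ ℤ.*_) (∑-δ f v))) ⟩
    ∑[ i < n ] (weight i ℤ.* f i) ℤ.+ ℤ.-1ℤ ℤ.* f v
      ≡⟨ cong (ℤ._+_ (∑[ i < n ] (weight i ℤ.* f i))) (ℤP.-1*i≡-i (f v)) ⟩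
    ∑[ i < n ] (weight i ℤ.* f i) ℤ.- f v ∎
    where
    open ≡-Reasoning
    distrib : ∀ w d x → (w ℤ.- d) ℤ.* x ≡ w ℤ.* x ℤ.+ ℤ.-1ℤ ℤ.* (d ℤ.* x)
    distrib = solve-∀

  weight⁺-sum : ∑[ i < suc n ] weight⁺ i ≡ + 2
  weight⁺-sum = begin
    + 1 ℤ.+ ∑[ i < n ] weight⁺ (suc i)
      ≡⟨ cong (ℤ._+_ (+ 1)) (sum-cong-≗ (λ i → sym (ℤP.*-identityʳ (weight⁺ (suc i))))) ⟩
    + 1 ℤ.+ ∑[ i < n ] (weight⁺ (suc i) ℤ.* + 1)
      ≡⟨ cong (ℤ._+_ (+ 1)) (shifted-sum (λ _ → + 1)) ⟩
    + 1 ℤ.+ (∑[ i < n ] (weight i ℤ.* + 1) ℤ.- + 1)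
      ≡⟨ cong (λ s → + 1 ℤ.+ (s ℤ.- + 1)) (trans (sum-cong-≗ (λ i → ℤP.*-identityʳ (weight i))) weight-sum) ⟩
    + 2 ∎
    where open ≡-Reasoning

  column-sum⁺ : ∀ {D⁺} → IsDistanceMatrix (addPendant G v) D⁺ →
                ∀ c → ∑[ i < suc n ] (weight⁺ i ℤ.* + D⁺ i c) ≡ a ℤ.+ + 1
  column-sum⁺ {D⁺} isD⁺ zero = begin
    + 1 ℤ.* + D⁺ zero zero ℤ.+ ∑[ i < n ] (weight⁺ (suc i) ℤ.* + D⁺ (suc i) zero)
      ≡⟨ cong₂ (λ d s → + 1 ℤ.* + d ℤ.+ s) (distance-refl isD⁺ zero)
               (sum-cong-≗ (λ i → cong (λ d → weight⁺ (suc i) ℤ.* + d) (D⁺-to-pendant isD⁺ i))) ⟩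
    + 0 ℤ.+ ∑[ i < n ] (weight⁺ (suc i) ℤ.* + suc (D isD⁺ i v))
      ≡⟨ cong (ℤ._+_ (+ 0)) (shifted-sum (λ i → + suc (D isD⁺ i v))) ⟩
    + 0 ℤ.+ (∑[ i < n ] (weight i ℤ.* + suc (D isD⁺ i v)) ℤ.- + suc (D isD⁺ v v))
      ≡⟨ cong₂ (λ s d → + 0 ℤ.+ (s ℤ.- + suc d)) expand (distance-refl (D-isDistanceMatrix isD⁺) v) ⟩
    + 0 ℤ.+ ((a ℤ.+ + 2) ℤ.- + 1)
      ≡⟨ simplify a ⟩
    a ℤ.+ + 1 ∎
    where
    open ≡-Reasoning
    simplify : ∀ a → + 0 ℤ.+ ((a ℤ.+ + 2) ℤ.- + 1) ≡ a ℤ.+ + 1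
    simplify = solve-∀
    suc-distrib : ∀ w d → w ℤ.* (+ 1 ℤ.+ d) ≡ w ℤ.* d ℤ.+ w
    suc-distrib = solve-∀
    expand : ∑[ i < n ] (weight i ℤ.* + suc (D isD⁺ i v)) ≡ a ℤ.+ + 2
    expand = begin
      ∑[ i < n ] (weight i ℤ.* + suc (D isD⁺ i v))
        ≡⟨ sum-cong-≗ (λ i → suc-distrib (weight i) (+ D isD⁺ i v)) ⟩
      ∑[ i < n ] (weight i ℤ.* + D isD⁺ i v ℤ.+ weight i)
        ≡⟨ ∑-distrib-+ (λ i → weight i ℤ.* + D isD⁺ i v) weight ⟩
      ∑[ i < n ] (weight i ℤ.* + D isD⁺ i v) ℤ.+ ∑[ i < n ] weight i
        ≡⟨ cong₂ ℤ._+_ (column-sum (D-isDistanceMatrix isD⁺) v) weight-sum ⟩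
      a ℤ.+ + 2 ∎
  column-sum⁺ {D⁺} isD⁺ (suc c) = begin
    + 1 ℤ.* + D⁺ zero (suc c) ℤ.+ ∑[ i < n ] (weight⁺ (suc i) ℤ.* + D⁺ (suc i) (suc c))
      ≡⟨ cong₂ (λ d s → + 1 ℤ.* + d ℤ.+ s) (D⁺-from-pendant isD⁺ c) (shifted-sum (λ i → + D isD⁺ i c)) ⟩
    + 1 ℤ.* + suc (D isD⁺ v c) ℤ.+ (∑[ i < n ] (weight i ℤ.* + D isD⁺ i c) ℤ.- + D isD⁺ v c)
      ≡⟨ cong (λ s → + 1 ℤ.* + suc (D isD⁺ v c) ℤ.+ (s ℤ.- + D isD⁺ v c)) (column-sum (D-isDistanceMatrix isD⁺) c) ⟩
    + 1 ℤ.* (+ 1 ℤ.+ + D isD⁺ v c) ℤ.+ (a ℤ.- + D isD⁺ v c)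
      ≡⟨ simplify a (+ D isD⁺ v c) ⟩
    a ℤ.+ + 1 ∎
    where
    open ≡-Reasoning
    simplify : ∀ a d → + 1 ℤ.* (+ 1 ℤ.+ d) ℤ.+ (a ℤ.- d) ≡ a ℤ.+ + 1
    simplify = solve-∀

ι : ℤ → ℚ
ι z = z ℚ./ 1

private
  toℚᵘ-ι : ∀ z → ℚ.toℚᵘ (ι z) ℚᵘ.≃ ℚᵘ.mkℚᵘ z 0
  toℚᵘ-ι z = ℚP.toℚᵘ-fromℚᵘ (ℚᵘ.mkℚᵘ z 0)

ι-+ : ∀ a b → ι (a ℤ.+ b) ≡ ι a ℚ.+ ι b
ι-+ a b = ℚP.toℚᵘ-injective (begin
  ℚ.toℚᵘ (ι (a ℤ.+ b))               ≈⟨ toℚᵘ-ι (a ℤ.+ b) ⟩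
  ℚᵘ.mkℚᵘ (a ℤ.+ b) 0                ≈⟨ ℚᵘ.*≡* (lemma a b) ⟩
  ℚᵘ.mkℚᵘ a 0 ℚᵘ.+ ℚᵘ.mkℚᵘ b 0       ≈⟨ ℚᵘP.+-cong (toℚᵘ-ι a) (toℚᵘ-ι b) ⟨
  ℚ.toℚᵘ (ι a) ℚᵘ.+ ℚ.toℚᵘ (ι b)     ≈⟨ ℚP.toℚᵘ-homo-+ (ι a) (ι b) ⟨
  ℚ.toℚᵘ (ι a ℚ.+ ι b)               ∎)
  where
  open ℚᵘP.≃-Reasoning
  lemma : ∀ a b → (a ℤ.+ b) ℤ.* (+ 1 ℤ.* + 1) ≡ (a ℤ.* + 1 ℤ.+ b ℤ.* + 1) ℤ.* + 1
  lemma = solve-∀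

ι-* : ∀ a b → ι (a ℤ.* b) ≡ ι a ℚ.* ι b
ι-* a b = ℚP.toℚᵘ-injective (begin
  ℚ.toℚᵘ (ι (a ℤ.* b))               ≈⟨ toℚᵘ-ι (a ℤ.* b) ⟩
  ℚᵘ.mkℚᵘ (a ℤ.* b) 0                ≈⟨ ℚᵘ.*≡* (lemma a b) ⟩
  ℚᵘ.mkℚᵘ a 0 ℚᵘ.* ℚᵘ.mkℚᵘ b 0       ≈⟨ ℚᵘP.*-cong (toℚᵘ-ι a) (toℚᵘ-ι b) ⟨
  ℚ.toℚᵘ (ι a) ℚᵘ.* ℚ.toℚᵘ (ι b)     ≈⟨ ℚP.toℚᵘ-homo-* (ι a) (ι b) ⟨
  ℚ.toℚᵘ (ι a ℚ.* ι b)               ∎)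
  where
  open ℚᵘP.≃-Reasoning
  lemma : ∀ a b → (a ℤ.* b) ℤ.* (+ 1 ℤ.* + 1) ≡ (a ℤ.* b) ℤ.* + 1
  lemma = solve-∀

ι-sum : ∀ {n} (f : Fin n → ℤ) → ι (∑[ i < n ] f i) ≡ ℚΣ.∑[ i < n ] ι (f i)
ι-sum {zero}  f = refl
ι-sum {suc n} f = trans (ι-+ (f zero) _) (cong (ℚ._+_ (ι (f zero))) (ι-sum (λ i → f (suc i))))

sumFin≡sum : ∀ {n} (f : Fin n → ℚ) → sumFin f ≡ ℚΣ.∑[ i < n ] f i
sumFin≡sum {zero}  f = refl
sumFin≡sum {suc n} f = cong (ℚ._+_ (f zero)) (sumFin≡sum (λ i → f (suc i)))

Certificate⇒DistanceExceptional : ∀ {n} {G : Graph n} → Certificate G (+ 0) → DistanceExceptional G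
Certificate⇒DistanceExceptional {n} C D isD (x , Dx≡1) = ι2≢0 (trans (sym pairing≡2) pairing≡0)
  where
  open Certificate C
  open ≡-Reasoning
  y : Fin n → ℚ
  y i = ι (weight i)
  pairing : ℚ
  pairing = ℚΣ.∑[ i < n ] (y i ℚ.* ℚΣ.∑[ c < n ] (ℕtoℚ (D i c) ℚ.* x c))
  pairing≡2 : pairing ≡ ι (+ 2)
  pairing≡2 = begin
    pairing
      ≡⟨ ℚΣ.sum-cong-≗ (λ i → trans (cong (y i ℚ.*_) (trans (sym (sumFin≡sum (λ c → ℕtoℚ (D i c) ℚ.* x c))) (Dx≡1 i)))
                                    (ℚP.*-identityʳ (y i))) ⟩
    ℚΣ.∑[ i < n ] y i
      ≡⟨ ι-sum weight ⟨
    ι (∑[ i < n ] weight i)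
      ≡⟨ cong ι weight-sum ⟩
    ι (+ 2) ∎
  pairing≡0 : pairing ≡ 0ℚ
  pairing≡0 = begin
    pairing
      ≡⟨ ℚΣ.sum-cong-≗ (λ i → ℚΣ.*-distribˡ-sum (y i) (λ c → ℕtoℚ (D i c) ℚ.* x c)) ⟩
    ℚΣ.∑[ i < n ] ℚΣ.∑[ c < n ] (y i ℚ.* (ℕtoℚ (D i c) ℚ.* x c))
      ≡⟨ ℚΣ.∑-comm (λ i c → y i ℚ.* (ℕtoℚ (D i c) ℚ.* x c)) ⟩
    ℚΣ.∑[ c < n ] ℚΣ.∑[ i < n ] (y i ℚ.* (ℕtoℚ (D i c) ℚ.* x c))
      ≡⟨ ℚΣ.sum-cong-≗ (λ c → column c) ⟩
    ℚΣ.∑[ c < n ] 0ℚ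
      ≡⟨ ℚΣ.sum-replicate-zero n ⟩
    0ℚ ∎
    where
    column : ∀ c → ℚΣ.∑[ i < n ] (y i ℚ.* (ℕtoℚ (D i c) ℚ.* x c)) ≡ 0ℚ
    column c = begin
      ℚΣ.∑[ i < n ] (y i ℚ.* (ℕtoℚ (D i c) ℚ.* x c))
        ≡⟨ ℚΣ.sum-cong-≗ (λ i → trans (sym (ℚP.*-assoc (y i) _ (x c))) (cong (ℚ._* x c) (sym (ι-* (weight i) (+ D i c))))) ⟩
      ℚΣ.∑[ i < n ] (ι (weight i ℤ.* + D i c) ℚ.* x c)
        ≡⟨ ℚΣ.*-distribʳ-sum (x c) (λ i → ι (weight i ℤ.* + D i c)) ⟨
      ℚΣ.∑[ i < n ] ι (weight i ℤ.* + D i c) ℚ.* x c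
        ≡⟨ cong (ℚ._* x c) (trans (sym (ι-sum (λ i → weight i ℤ.* + D i c))) (cong ι (column-sum isD c))) ⟩
      0ℚ ℚ.* x c
        ≡⟨ ℚP.*-zeroˡ (x c) ⟩
      0ℚ ∎
  ι2≢0 : ι (+ 2) ≢ 0ℚ
  ι2≢0 ()

Certificate-obtained : ∀ {k a i n G} → Certificate (Basket k) a → Obtained k i n G → Certificate G (a ℤ.+ + i)
Certificate-obtained {a = a} C base                 = subst (Certificate _) (sym (ℤP.+-identityʳ a)) C
Certificate-obtained {a = a} C (step {i = i} obt v) =
  subst (Certificate _) (trans (ℤP.+-assoc a (+ i) (+ 1)) (cong (λ m → a ℤ.+ + m) (ℕP.+-comm i 1)))
        (Certificate-addPendant (Certificate-obtained C obt) v)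

∑ℕ : ℕ → (ℕ → ℤ) → ℤ
∑ℕ a f = ∑[ i < a ] f (toℕ i)

∑ℕ-cong : ∀ a {f g : ℕ → ℤ} → (∀ t → t < a → f t ≡ g t) → ∑ℕ a f ≡ ∑ℕ a g
∑ℕ-cong a f≡g = sum-cong-≗ (λ i → f≡g (toℕ i) (FinP.toℕ<n i))

∑ℕ-+ : ∀ a (f g : ℕ → ℤ) → ∑ℕ a (λ t → f t ℤ.+ g t) ≡ ∑ℕ a f ℤ.+ ∑ℕ a g
∑ℕ-+ a f g = ∑-distrib-+ {a} (f ∘ toℕ) (g ∘ toℕ)

∑ℕ-* : ∀ a c (f : ℕ → ℤ) → ∑ℕ a (λ t → c ℤ.* f t) ≡ c ℤ.* ∑ℕ a f
∑ℕ-* a c f = sym (*-distribˡ-sum {a} c (f ∘ toℕ))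

∑ℕ-split : ∀ a b (f : ℕ → ℤ) → ∑ℕ (a + b) f ≡ ∑ℕ a f ℤ.+ ∑ℕ b (λ t → f (a + t))
∑ℕ-split zero    b f = sym (ℤP.+-identityˡ _)
∑ℕ-split (suc a) b f = trans (cong (ℤ._+_ (f 0)) (∑ℕ-split a b (f ∘ suc))) (sym (ℤP.+-assoc (f 0) _ _))

∑ℕ-last : ∀ a (f : ℕ → ℤ) → ∑ℕ (suc a) f ≡ ∑ℕ a f ℤ.+ f a
∑ℕ-last a f = begin
  ∑ℕ (suc a) f              ≡⟨ cong (λ b → ∑ℕ b f) (ℕP.+-comm 1 a) ⟩
  ∑ℕ (a + 1) f              ≡⟨ ∑ℕ-split a 1 f ⟩
  ∑ℕ a f ℤ.+ (f (a + 0) ℤ.+ + 0) ≡⟨ cong (ℤ._+_ (∑ℕ a f)) (trans (ℤP.+-identityʳ _) (cong f (ℕP.+-identityʳ a))) ⟩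
  ∑ℕ a f ℤ.+ f a            ∎
  where open ≡-Reasoning

∑ℕ-blocks : ∀ m b (f : ℕ → ℤ) → ∑ℕ (m * b) f ≡ ∑[ i < m ] ∑ℕ b (λ t → f (toℕ i * b + t))
∑ℕ-blocks zero    b f = refl
∑ℕ-blocks (suc m) b f = begin
  ∑ℕ (b + m * b) f
    ≡⟨ ∑ℕ-split b (m * b) f ⟩
  ∑ℕ b f ℤ.+ ∑ℕ (m * b) (λ t → f (b + t))
    ≡⟨ cong (ℤ._+_ (∑ℕ b f)) (∑ℕ-blocks m b (λ t → f (b + t))) ⟩
  ∑ℕ b f ℤ.+ ∑[ i < m ] ∑ℕ b (λ t → f (b + (toℕ i * b + t)))
    ≡⟨ cong (ℤ._+_ (∑ℕ b f)) (sum-cong-≗ {m} (λ i → ∑ℕ-cong b (λ t _ → cong f (sym (ℕP.+-assoc b (toℕ i * b) t))))) ⟩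
  ∑ℕ b f ℤ.+ ∑[ i < m ] ∑ℕ b (λ t → f (b + toℕ i * b + t))
    ∎
  where open ≡-Reasoning

∑ℕ-reverse : ∀ a (f : ℕ → ℤ) → ∑ℕ (suc a) (λ t → f (a ∸ t)) ≡ ∑ℕ (suc a) f
∑ℕ-reverse zero    f = refl
∑ℕ-reverse (suc a) f = begin
  f (suc a) ℤ.+ ∑ℕ (suc a) (λ t → f (a ∸ t)) ≡⟨ cong (ℤ._+_ (f (suc a))) (∑ℕ-reverse a f) ⟩
  f (suc a) ℤ.+ ∑ℕ (suc a) f                 ≡⟨ ℤP.+-comm (f (suc a)) _ ⟩
  ∑ℕ (suc a) f ℤ.+ f (suc a)                 ≡⟨ ∑ℕ-last (suc a) f ⟨
  ∑ℕ (suc (suc a)) f                         ∎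
  where open ≡-Reasoning

∑ℕ-δ : ∀ a (g : ℕ → ℤ) {s} → s < a → ∑ℕ a (λ t → g t ℤ.* δ t s) ≡ g s
∑ℕ-δ a g {s} s<a = begin
  ∑ℕ a (λ t → g t ℤ.* δ t s)                             ≡⟨ ∑ℕ-cong a (λ t _ → ℤP.*-comm (g t) (δ t s)) ⟩
  ∑ℕ a (λ t → δ t s ℤ.* g t)                             ≡⟨ cong (λ s′ → ∑ℕ a (λ t → δ t s′ ℤ.* g t)) (sym s≡v) ⟩
  ∑[ i < a ] (δ (toℕ i) (toℕ v) ℤ.* g (toℕ i))           ≡⟨ ∑-δ {a} (g ∘ toℕ) v ⟩
  g (toℕ v)                                              ≡⟨ cong g s≡v ⟩
  g s                                                    ∎
  where
  open ≡-Reasoning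
  v : Fin a
  v = fromℕ< s<a
  s≡v : toℕ v ≡ s
  s≡v = FinP.toℕ-fromℕ< s<a

∑ℕ-geometric : ∀ x a → (+ 1 ℤ.- x) ℤ.* ∑ℕ a (x ℤ.^_) ℤ.+ x ℤ.^ a ≡ + 1
∑ℕ-geometric x zero    = empty x
  where
  empty : ∀ x → (+ 1 ℤ.- x) ℤ.* + 0 ℤ.+ + 1 ≡ + 1
  empty = solve-∀
∑ℕ-geometric x (suc a) = begin
  (+ 1 ℤ.- x) ℤ.* (+ 1 ℤ.+ ∑ℕ a (λ t → x ℤ.* x ℤ.^ t)) ℤ.+ x ℤ.* x ℤ.^ a
    ≡⟨ cong (λ s → (+ 1 ℤ.- x) ℤ.* (+ 1 ℤ.+ s) ℤ.+ x ℤ.* x ℤ.^ a) (∑ℕ-* a x (x ℤ.^_)) ⟩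
  (+ 1 ℤ.- x) ℤ.* (+ 1 ℤ.+ x ℤ.* ∑ℕ a (x ℤ.^_)) ℤ.+ x ℤ.* x ℤ.^ a
    ≡⟨ regroup x (∑ℕ a (x ℤ.^_)) (x ℤ.^ a) ⟩
  (+ 1 ℤ.- x) ℤ.+ x ℤ.* ((+ 1 ℤ.- x) ℤ.* ∑ℕ a (x ℤ.^_) ℤ.+ x ℤ.^ a)
    ≡⟨ cong (λ s → (+ 1 ℤ.- x) ℤ.+ x ℤ.* s) (∑ℕ-geometric x a) ⟩
  (+ 1 ℤ.- x) ℤ.+ x ℤ.* + 1
    ≡⟨ cancel x ⟩
  + 1 ∎
  where
  open ≡-Reasoning
  regroup : ∀ x s p → (+ 1 ℤ.- x) ℤ.* (+ 1 ℤ.+ x ℤ.* s) ℤ.+ x ℤ.* p ≡ (+ 1 ℤ.- x) ℤ.+ x ℤ.* ((+ 1 ℤ.- x) ℤ.* s ℤ.+ p)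
  regroup = solve-∀
  cancel : ∀ x → (+ 1 ℤ.- x) ℤ.+ x ℤ.* + 1 ≡ + 1
  cancel = solve-∀

pointMasses : List (ℤ × ℕ) → ℕ → ℤ
pointMasses []             t = + 0
pointMasses ((c , s) ∷ cs) t = c ℤ.* δ t s ℤ.+ pointMasses cs t

integrate : (ℕ → ℤ) → List (ℤ × ℕ) → ℤ
integrate g []             = + 0
integrate g ((c , s) ∷ cs) = c ℤ.* g s ℤ.+ integrate g cs

∑ℕ-pointMasses : ∀ a (g : ℕ → ℤ) {cs} → All (λ m → proj₂ m < a) cs →
                 ∑ℕ a (λ t → g t ℤ.* pointMasses cs t) ≡ integrate g cs
∑ℕ-pointMasses a g []                        = trans (∑ℕ-cong a (λ t _ → ℤP.*-zeroʳ (g t))) (sum-replicate-zero a)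
∑ℕ-pointMasses a g {(c , s) ∷ cs} (s<a ∷ cs<a) = begin
  ∑ℕ a (λ t → g t ℤ.* (c ℤ.* δ t s ℤ.+ pointMasses cs t))
    ≡⟨ ∑ℕ-cong a (λ t _ → distrib (g t) c (δ t s) (pointMasses cs t)) ⟩
  ∑ℕ a (λ t → c ℤ.* (g t ℤ.* δ t s) ℤ.+ g t ℤ.* pointMasses cs t)
    ≡⟨ ∑ℕ-+ a (λ t → c ℤ.* (g t ℤ.* δ t s)) (λ t → g t ℤ.* pointMasses cs t) ⟩
  ∑ℕ a (λ t → c ℤ.* (g t ℤ.* δ t s)) ℤ.+ ∑ℕ a (λ t → g t ℤ.* pointMasses cs t)
    ≡⟨ cong₂ ℤ._+_ (trans (∑ℕ-* a c (λ t → g t ℤ.* δ t s)) (cong (ℤ._*_ c) (∑ℕ-δ a g s<a))) (∑ℕ-pointMasses a g cs<a) ⟩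
  c ℤ.* g s ℤ.+ integrate g cs ∎
  where
  open ≡-Reasoning
  distrib : ∀ g c d p → g ℤ.* (c ℤ.* d ℤ.+ p) ≡ c ℤ.* (g ℤ.* d) ℤ.+ g ℤ.* p
  distrib = solve-∀

∑ℕ-affine : ∀ a (g h : ℕ → ℤ) c₀ cs → All (λ m → proj₂ m < a) cs → (∀ t → t < a → h t ≡ c₀ ℤ.+ pointMasses cs t) →
            ∑ℕ a (λ t → g t ℤ.* h t) ≡ c₀ ℤ.* ∑ℕ a g ℤ.+ integrate g cs
∑ℕ-affine a g h c₀ cs cs<a h≡ = begin
  ∑ℕ a (λ t → g t ℤ.* h t)
    ≡⟨ ∑ℕ-cong a (λ t t<a → trans (cong (ℤ._*_ (g t)) (h≡ t t<a)) (ℤP.*-distribˡ-+ (g t) c₀ (pointMasses cs t))) ⟩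
  ∑ℕ a (λ t → g t ℤ.* c₀ ℤ.+ g t ℤ.* pointMasses cs t)
    ≡⟨ ∑ℕ-+ a (λ t → g t ℤ.* c₀) (λ t → g t ℤ.* pointMasses cs t) ⟩
  ∑ℕ a (λ t → g t ℤ.* c₀) ℤ.+ ∑ℕ a (λ t → g t ℤ.* pointMasses cs t)
    ≡⟨ cong₂ ℤ._+_ (trans (∑ℕ-cong a (λ t _ → ℤP.*-comm (g t) c₀)) (∑ℕ-* a c₀ g)) (∑ℕ-pointMasses a g cs<a) ⟩
  c₀ ℤ.* ∑ℕ a g ℤ.+ integrate g cs ∎
  where open ≡-Reasoning

-- Finite differences of distance profiles

Δ : (ℕ → ℤ) → ℕ → ℤ
Δ f x = f (suc x) ℤ.- f x

Δ² : (ℕ → ℤ) → ℕ → ℤ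
Δ² f x = f (suc (suc x)) ℤ.- + 2 ℤ.* f (suc x) ℤ.+ f x

Δ²-cong : ∀ {f g : ℕ → ℤ} x → (∀ y → f y ≡ g y) → Δ² f x ≡ Δ² g x
Δ²-cong x f≗g = cong₂ ℤ._+_ (cong₂ (λ a b → a ℤ.- + 2 ℤ.* b) (f≗g _) (f≗g _)) (f≗g x)

Δ-cong : ∀ {f g : ℕ → ℤ} x → (∀ y → f y ≡ g y) → Δ f x ≡ Δ g x
Δ-cong x f≗g = cong₂ ℤ._-_ (f≗g _) (f≗g x)

Δ-vanishing : ∀ N (f : ℕ → ℤ) → Δ f 0 ≡ + 0 → (∀ x → 2 + x ≤ N → Δ² f x ≡ + 0) →
              ∀ x → suc x ≤ N → Δ f x ≡ + 0
Δ-vanishing N f Δf0 Δ²f zero    _      = Δf0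
Δ-vanishing N f Δf0 Δ²f (suc x) 2+x≤N = begin
  Δ f (suc x)               ≡⟨ split (f (suc (suc x))) (f (suc x)) (f x) ⟩
  Δ² f x ℤ.+ Δ f x          ≡⟨ cong₂ ℤ._+_ (Δ²f x 2+x≤N) (Δ-vanishing N f Δf0 Δ²f x (ℕP.≤-trans (ℕP.n≤1+n _) 2+x≤N)) ⟩
  + 0                       ∎
  where
  open ≡-Reasoning
  split : ∀ a b c → a ℤ.- b ≡ a ℤ.- + 2 ℤ.* b ℤ.+ c ℤ.+ (b ℤ.- c)
  split = solve-∀

Δ-vanishing⇒constant : ∀ N (f : ℕ → ℤ) → Δ f 0 ≡ + 0 → (∀ x → 2 + x ≤ N → Δ² f x ≡ + 0) →
                       ∀ x → x ≤ N → f x ≡ f 0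
Δ-vanishing⇒constant N f Δf0 Δ²f zero    _   = refl
Δ-vanishing⇒constant N f Δf0 Δ²f (suc x) x<N = begin
  f (suc x)                 ≡⟨ shift (f (suc x)) (f x) ⟩
  Δ f x ℤ.+ f x             ≡⟨ cong₂ ℤ._+_ (Δ-vanishing N f Δf0 Δ²f x x<N) (Δ-vanishing⇒constant N f Δf0 Δ²f x (ℕP.<⇒≤ x<N)) ⟩
  + 0 ℤ.+ f 0               ≡⟨ ℤP.+-identityˡ (f 0) ⟩
  f 0                       ∎
  where
  open ≡-Reasoning
  shift : ∀ a b → a ≡ a ℤ.- b ℤ.+ b
  shift = solve-∀

∣-∣-Δ² : ∀ t x → Δ² (λ y → + ∣ t - y ∣) x ≡ + 2 ℤ.* δ t (suc x)
∣-∣-Δ² zero          x       = flat (+ x)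
  where
  flat : ∀ x → + 1 ℤ.+ (+ 1 ℤ.+ x) ℤ.- + 2 ℤ.* (+ 1 ℤ.+ x) ℤ.+ x ≡ + 2 ℤ.* + 0
  flat = solve-∀
∣-∣-Δ² (suc zero)    zero    = refl
∣-∣-Δ² (suc (suc t)) zero    rewrite ℕP.∣-∣-identityʳ t = flat (+ t)
  where
  flat : ∀ t → t ℤ.- + 2 ℤ.* (+ 1 ℤ.+ t) ℤ.+ (+ 1 ℤ.+ (+ 1 ℤ.+ t)) ≡ + 2 ℤ.* + 0
  flat = solve-∀
∣-∣-Δ² (suc t)       (suc x) = ∣-∣-Δ² t x

∣-∣-Δ : ∀ t → Δ (λ y → + ∣ t - y ∣) 0 ≡ ℤ.-1ℤ ℤ.+ + 2 ℤ.* δ t 0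
∣-∣-Δ zero    = refl
∣-∣-Δ (suc t) rewrite ℕP.∣-∣-identityʳ t = flat (+ t)
  where
  flat : ∀ t → t ℤ.- (+ 1 ℤ.+ t) ≡ ℤ.-1ℤ ℤ.+ + 2 ℤ.* + 0
  flat = solve-∀

⊓-Δ² : ∀ y w → + (suc (suc y) ⊓ w) ℤ.- + 2 ℤ.* + (suc y ⊓ suc w) ℤ.+ + (y ⊓ suc (suc w))
             ≡ ℤ.- (δ y w ℤ.+ δ y w ℤ.+ (δ (suc y) w ℤ.+ δ y (suc w)))
⊓-Δ² zero          zero          = refl
⊓-Δ² zero          (suc zero)    = refl
⊓-Δ² zero          (suc (suc w)) = refl
⊓-Δ² (suc zero)    zero          = refl
⊓-Δ² (suc (suc y)) zero          rewrite ℕP.⊓-zeroʳ y = refl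
⊓-Δ² (suc y)       (suc w)       = trans (drop-suc (+ (suc (suc y) ⊓ w)) (+ (suc y ⊓ suc w)) (+ (y ⊓ suc (suc w)))) (⊓-Δ² y w)
  where
  drop-suc : ∀ a b c → + 1 ℤ.+ a ℤ.- + 2 ℤ.* (+ 1 ℤ.+ b) ℤ.+ (+ 1 ℤ.+ c) ≡ a ℤ.- + 2 ℤ.* b ℤ.+ c
  drop-suc = solve-∀

⊓-Δ : ∀ y w → y ≤ w → + (suc y ⊓ w) ℤ.- + (y ⊓ suc w) ≡ + 1 ℤ.- δ y w
⊓-Δ zero    zero    _         = refl
⊓-Δ zero    (suc w) _         = refl
⊓-Δ (suc y) (suc w) (s≤s y≤w) = trans (drop-suc (+ (suc y ⊓ w)) (+ (y ⊓ suc w))) (⊓-Δ y w y≤w)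
  where
  drop-suc : ∀ a b → + 1 ℤ.+ a ℤ.- (+ 1 ℤ.+ b) ≡ a ℤ.- b
  drop-suc = solve-∀

-- The distance between the vertex a steps after hub 0 (and b steps before hub 1)
-- on one path and the vertex y steps after hub 0 on another path of length ℓ.
crossProfile : ℕ → ℕ → ℕ → ℕ → ℤ
crossProfile a b ℓ y = + ((a + y) ⊓ (b + (ℓ ∸ y)))

crossProfile-Δ²-kinks : ∀ a b x r → Δ² (crossProfile a b (x + suc (suc r))) x
                      ≡ ℤ.- (δ (a + x) (b + r) ℤ.+ δ (a + x) (b + r) ℤ.+ (δ (suc (a + x)) (b + r) ℤ.+ δ (a + x) (suc (b + r))))
crossProfile-Δ²-kinks a b x r = begin
  f (suc (suc x)) ℤ.- + 2 ℤ.* f (suc x) ℤ.+ f x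
    ≡⟨ cong₂ ℤ._+_ (cong₂ (λ p q → p ℤ.- + 2 ℤ.* q) at-x+2 at-x+1) at-x ⟩
  + (suc (suc (a + x)) ⊓ (b + r)) ℤ.- + 2 ℤ.* + (suc (a + x) ⊓ suc (b + r)) ℤ.+ + ((a + x) ⊓ suc (suc (b + r)))
    ≡⟨ ⊓-Δ² (a + x) (b + r) ⟩
  ℤ.- (δ (a + x) (b + r) ℤ.+ δ (a + x) (b + r) ℤ.+ (δ (suc (a + x)) (b + r) ℤ.+ δ (a + x) (suc (b + r)))) ∎
  where
  open ≡-Reasoning
  f = crossProfile a b (x + suc (suc r))
  at-x+2 : f (suc (suc x)) ≡ + (suc (suc (a + x)) ⊓ (b + r))
  at-x+2 = cong +_ (cong₂ _⊓_ (trans (ℕP.+-suc a (suc x)) (cong suc (ℕP.+-suc a x)))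
                              (cong (_+_ b) (trans (cong (_∸ suc (suc x)) (trans (ℕP.+-suc x (suc r)) (cong suc (ℕP.+-suc x r))))
                                                   (ℕP.m+n∸m≡n x r))))
  at-x+1 : f (suc x) ≡ + (suc (a + x) ⊓ suc (b + r))
  at-x+1 = cong +_ (cong₂ _⊓_ (ℕP.+-suc a x)
                              (trans (cong (_+_ b) (trans (cong (_∸ suc x) (ℕP.+-suc x (suc r))) (ℕP.m+n∸m≡n x (suc r))))
                                     (ℕP.+-suc b r)))
  at-x : f x ≡ + ((a + x) ⊓ suc (suc (b + r)))
  at-x = cong +_ (cong ((a + x) ⊓_) (trans (cong (_+_ b) (ℕP.m+n∸m≡n x (suc (suc r))))
                                           (trans (ℕP.+-suc b (suc r)) (cong suc (ℕP.+-suc b r)))))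

before-kink : ∀ {a b L ℓ} → a + b ≡ L → a + a ≤ L + ℓ → a ≤ b + ℓ
before-kink {a} {b} {L} {ℓ} a+b≡L 2a≤ = ℕP.+-cancelˡ-≤ a a (b + ℓ)
  (subst (a + a ≤_) (trans (cong (_+ ℓ) (sym a+b≡L)) (ℕP.+-assoc a b ℓ)) 2a≤)

crossProfile-Δ-kink : ∀ a b ℓ → a ≤ b + ℓ → Δ (crossProfile a b (suc ℓ)) 0 ≡ + 1 ℤ.- δ a (b + ℓ)
crossProfile-Δ-kink a b ℓ a≤b+ℓ = begin
  + ((a + 1) ⊓ (b + ℓ)) ℤ.- + ((a + 0) ⊓ (b + suc ℓ))
    ≡⟨ cong₂ (λ p q → + (p ⊓ (b + ℓ)) ℤ.- + (q ⊓ (b + suc ℓ))) (ℕP.+-comm a 1) (ℕP.+-identityʳ a) ⟩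
  + (suc a ⊓ (b + ℓ)) ℤ.- + (a ⊓ (b + suc ℓ))
    ≡⟨ cong (λ q → + (suc a ⊓ (b + ℓ)) ℤ.- + (a ⊓ q)) (ℕP.+-suc b ℓ) ⟩
  + (suc a ⊓ (b + ℓ)) ℤ.- + (a ⊓ suc (b + ℓ))
    ≡⟨ ⊓-Δ a (b + ℓ) a≤b+ℓ ⟩
  + 1 ℤ.- δ a (b + ℓ) ∎
  where open ≡-Reasoning

-- The profile kinks where a + x meets b + r; adding a to both sides turns this
-- into a + a meeting D, so the kink is located by the parity of D.
δ-fold : ∀ {a b L r x D} u v → a + b ≡ L → L + r ≡ x + D → δ (u + (a + x)) (v + (b + r)) ≡ δ (u + (a + a)) (v + D)
δ-fold {a} {b} {L} {r} {x} {D} u v a+b≡L L+r≡x+D = begin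
  δ (u + (a + x)) (v + (b + r))                   ≡⟨ δ-+ˡ a _ _ ⟨
  δ (a + (u + (a + x))) (a + (v + (b + r)))       ≡⟨ cong₂ δ (reorder a u x) shift ⟩
  δ (x + (u + (a + a))) (x + (v + D))             ≡⟨ δ-+ˡ x _ _ ⟩
  δ (u + (a + a)) (v + D)                         ∎
  where
  open ≡-Reasoning
  reorder : ∀ a u x → a + (u + (a + x)) ≡ x + (u + (a + a))
  reorder = ℕSolver.solve-∀
  shift : a + (v + (b + r)) ≡ x + (v + D)
  shift = begin
    a + (v + (b + r))  ≡⟨ assoc a v b r ⟩
    v + (a + b + r)    ≡⟨ cong (λ l → v + (l + r)) a+b≡L ⟩
    v + (L + r)        ≡⟨ cong (_+_ v) L+r≡x+D ⟩
    v + (x + D)        ≡⟨ ℕP.+-comm v (x + D) ⟩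
    x + D + v          ≡⟨ ℕP.+-assoc x D v ⟩
    x + (D + v)        ≡⟨ cong (_+_ x) (ℕP.+-comm D v) ⟩
    x + (v + D)        ∎
    where
    assoc : ∀ a v b r → a + (v + (b + r)) ≡ v + (a + b + r)
    assoc = ℕSolver.solve-∀

crossProfile-Δ²-even : ∀ {a b L r x s} → a + b ≡ L → L + r ≡ x + (s + s) →
                       Δ² (crossProfile a b (x + suc (suc r))) x ≡ ℤ.- (+ 2 ℤ.* δ a s)
crossProfile-Δ²-even {a} {b} {L} {r} {x} {s} a+b≡L L+r≡x+D = begin
  Δ² (crossProfile a b (x + suc (suc r))) x
    ≡⟨ crossProfile-Δ²-kinks a b x r ⟩
  ℤ.- (δ (a + x) (b + r) ℤ.+ δ (a + x) (b + r) ℤ.+ (δ (suc (a + x)) (b + r) ℤ.+ δ (a + x) (suc (b + r))))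
    ≡⟨ cong₂ (λ p q → ℤ.- (p ℤ.+ p ℤ.+ q)) kink (cong₂ ℤ._+_ off-left off-right) ⟩
  ℤ.- (δ a s ℤ.+ δ a s ℤ.+ (+ 0 ℤ.+ + 0))
    ≡⟨ simplify (δ a s) ⟩
  ℤ.- (+ 2 ℤ.* δ a s) ∎
  where
  open ≡-Reasoning
  kink      = trans (δ-fold {a = a} {x = x} 0 0 a+b≡L L+r≡x+D) (δ-double a s)
  off-left  = trans (δ-fold {a = a} {x = x} 1 0 a+b≡L L+r≡x+D) (δ-odd-double a s)
  off-right = trans (δ-fold {a = a} {x = x} 0 1 a+b≡L L+r≡x+D) (δ-double-odd a s)
  simplify : ∀ d → ℤ.- (d ℤ.+ d ℤ.+ (+ 0 ℤ.+ + 0)) ≡ ℤ.- (+ 2 ℤ.* d)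
  simplify = solve-∀

crossProfile-Δ²-odd : ∀ {a b L r x s} → a + b ≡ L → L + r ≡ x + suc (s + s) →
                      Δ² (crossProfile a b (x + suc (suc r))) x ≡ ℤ.- (δ a s ℤ.+ δ a (suc s))
crossProfile-Δ²-odd {a} {b} {L} {r} {x} {s} a+b≡L L+r≡x+D = begin
  Δ² (crossProfile a b (x + suc (suc r))) x
    ≡⟨ crossProfile-Δ²-kinks a b x r ⟩
  ℤ.- (δ (a + x) (b + r) ℤ.+ δ (a + x) (b + r) ℤ.+ (δ (suc (a + x)) (b + r) ℤ.+ δ (a + x) (suc (b + r))))
    ≡⟨ cong₂ (λ p q → ℤ.- (p ℤ.+ p ℤ.+ q)) off (cong₂ ℤ._+_ left-kink right-kink) ⟩
  ℤ.- (+ 0 ℤ.+ + 0 ℤ.+ (δ a s ℤ.+ δ a (suc s)))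
    ≡⟨ simplify (δ a s ℤ.+ δ a (suc s)) ⟩
  ℤ.- (δ a s ℤ.+ δ a (suc s)) ∎
  where
  open ≡-Reasoning
  off        = trans (δ-fold {a = a} {x = x} 0 0 a+b≡L L+r≡x+D) (δ-double-odd a s)
  left-kink  = trans (δ-fold {a = a} {x = x} 1 0 a+b≡L L+r≡x+D) (δ-double a s)
  right-kink = trans (δ-fold {a = a} {x = x} 0 1 a+b≡L L+r≡x+D)
                     (trans (cong (δ (a + a)) (cong suc (sym (ℕP.+-suc s s)))) (δ-double a (suc s)))
  simplify : ∀ d → ℤ.- (+ 0 ℤ.+ + 0 ℤ.+ d) ≡ ℤ.- d
  simplify = solve-∀

crossProfile-Δ-even : ∀ {a b L ℓ s} → a + b ≡ L → L + ℓ ≡ s + s → a + a ≤ L + ℓ →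
                      Δ (crossProfile a b (suc ℓ)) 0 ≡ + 1 ℤ.- δ a s
crossProfile-Δ-even {a} {b} {L} {ℓ} {s} a+b≡L L+ℓ≡D 2a≤ =
  trans (crossProfile-Δ-kink a b ℓ (before-kink a+b≡L 2a≤))
        (cong (ℤ._-_ (+ 1)) (trans (cong (λ c → δ c (b + ℓ)) (sym (ℕP.+-identityʳ a)))
                                   (trans (δ-fold {a = a} {x = 0} 0 0 a+b≡L L+ℓ≡D) (δ-double a s))))

crossProfile-Δ-odd : ∀ {a b L ℓ s} → a + b ≡ L → L + ℓ ≡ suc (s + s) → a + a ≤ L + ℓ →
                     Δ (crossProfile a b (suc ℓ)) 0 ≡ + 1
crossProfile-Δ-odd {a} {b} {L} {ℓ} {s} a+b≡L L+ℓ≡D 2a≤ =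
  trans (crossProfile-Δ-kink a b ℓ (before-kink a+b≡L 2a≤))
        (cong (ℤ._-_ (+ 1)) (trans (cong (λ c → δ c (b + ℓ)) (sym (ℕP.+-identityʳ a)))
                                   (trans (δ-fold {a = a} {x = 0} 0 0 a+b≡L L+ℓ≡D) (δ-double-odd a s))))

-- The basket graph

pathVertex : ℕ → ℕ → ℕ → ℕ → ℕ → ℕ
pathVertex u v s m       zero    = u
pathVertex u v s zero    (suc t) = v
pathVertex u v s (suc m) (suc t) = pathVertex s v (suc s) m t

pathVertex-inner : ∀ u v s {m t} → t < m → pathVertex u v s m (suc t) ≡ s + t
pathVertex-inner u v s {suc m} {zero}  _         = sym (ℕP.+-identityʳ s)
pathVertex-inner u v s {suc m} {suc t} (s≤s t<m) = trans (pathVertex-inner s v (suc s) t<m) (sym (ℕP.+-suc s t))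

pathVertex-last : ∀ u v s m → pathVertex u v s m (suc m) ≡ v
pathVertex-last u v s zero    = refl
pathVertex-last u v s (suc m) = pathVertex-last s v (suc s) m

∈-pathEdges⁺ : ∀ u v s m {t} → t ≤ m → (pathVertex u v s m t , pathVertex u v s m (suc t)) ∈ pathEdges u v s m
∈-pathEdges⁺ u v s zero    {zero}  _         = here refl
∈-pathEdges⁺ u v s (suc m) {zero}  _         = here refl
∈-pathEdges⁺ u v s (suc m) {suc t} (s≤s t≤m) = there (∈-pathEdges⁺ s v (suc s) m t≤m)

∈-pathEdges⁻ : ∀ u v s m {e} → e ∈ pathEdges u v s m →
               ∃ λ t → t ≤ m × e ≡ (pathVertex u v s m t , pathVertex u v s m (suc t))
∈-pathEdges⁻ u v s zero    (here e≡) = 0 , z≤n , e≡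
∈-pathEdges⁻ u v s (suc m) (here e≡) = 0 , z≤n , e≡
∈-pathEdges⁻ u v s (suc m) (there e∈) with ∈-pathEdges⁻ s v (suc s) m e∈
... | t , t≤m , e≡ = suc t , s≤s t≤m , e≡

data Path : Set where
  short : Path
  long  : Fin 3 → Path

long-injective : ∀ {i j} → long i ≡ long j → i ≡ j
long-injective refl = refl

_≟ᴾ_ : DecidableEquality Path
short  ≟ᴾ short  = yes refl
short  ≟ᴾ long _ = no λ ()
long _ ≟ᴾ short  = no λ ()
long i ≟ᴾ long j = map′ (cong long) long-injective (i FinP.≟ j)

block : ℕ → Fin 3
block 0 = zero
block 1 = suc zero
block _ = suc (suc zero)

block-toℕ : ∀ i → block (toℕ i) ≡ i
block-toℕ zero             = refl
block-toℕ (suc zero)       = refl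
block-toℕ (suc (suc zero)) = refl

-- The basket B (M + 2): hubs 0 and 1 joined by a short path of length N = M + 1
-- and three long paths of length N + 1.  The coordinate (p , t) is the vertex t
-- steps from hub 0 along p, so every (p , 0) is hub 0 and every (p , len p) hub 1.
module BasketGraph (M : ℕ) where

  N k n : ℕ
  N = suc M
  k = suc N
  n = basketSize k

  inner : Path → ℕ
  inner short    = M
  inner (long _) = N

  len : Path → ℕ
  len p = suc (inner p)

  -- Numbering of the first inner vertex of each path in Defs.basketEdges.
  start : Path → ℕ
  start short                  = 2
  start (long zero)            = k
  start (long (suc zero))      = 2 * k ∸ 1
  start (long (suc (suc zero))) = 3 * k ∸ 2

  Coord : Set
  Coord = Path × ℕ

  index : Coord → ℕ
  index (p , t) = pathVertex 0 1 (start p) (inner p) t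

  n≡ : n ≡ 2 + (M + 3 * N)
  n≡ = trans (cong (_∸ 3) (four M)) (ℕP.m+n∸n≡m _ 3)
    where
    four : ∀ M → 4 * suc (suc M) ≡ 2 + (M + 3 * suc M) + 3
    four = ℕSolver.solve-∀

  start-long : ∀ i t → start (long i) + t ≡ 2 + (M + (t + toℕ i * N))
  start-long zero             t = first M t
    where
    first : ∀ M t → suc (suc M) + t ≡ 2 + (M + (t + 0 * suc M))
    first = ℕSolver.solve-∀
  start-long (suc zero)       t = second M t
    where
    second : ∀ M t → suc (M + (suc (suc M) + 0)) + t ≡ 2 + (M + (t + 1 * suc M))
    second = ℕSolver.solve-∀
  start-long (suc (suc zero)) t = third M t
    where
    third : ∀ M t → M + (suc (suc M) + (suc (suc M) + 0)) + t ≡ 2 + (M + (t + 2 * suc M))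
    third = ℕSolver.solve-∀

  index-inner : ∀ p {t} → t < inner p → index (p , suc t) ≡ start p + t
  index-inner p = pathVertex-inner 0 1 (start p)

  index-last : ∀ p → index (p , len p) ≡ 1
  index-last p = pathVertex-last 0 1 (start p) (inner p)

  edges : Path → List (ℕ × ℕ)
  edges p = pathEdges 0 1 (start p) (inner p)

  ∈-edges⁻ : ∀ p {e} → e ∈ edges p → ∃₂ λ q t → t < len q × e ≡ (index (q , t) , index (q , suc t))
  ∈-edges⁻ p e∈ with ∈-pathEdges⁻ 0 1 (start p) (inner p) e∈
  ... | t , t≤ , e≡ = p , t , s≤s t≤ , e≡

  basketEdge⁻ : ∀ {e} → e ∈ basketEdges k → ∃₂ λ p t → t < len p × e ≡ (index (p , t) , index (p , suc t))
  basketEdge⁻ e∈ with ∈-++⁻ (edges short) e∈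
  ... | inj₁ e∈₀ = ∈-edges⁻ short e∈₀
  ... | inj₂ e∈′ with ∈-++⁻ (edges (long zero)) e∈′
  ... | inj₁ e∈₁ = ∈-edges⁻ (long zero) e∈₁
  ... | inj₂ e∈″ with ∈-++⁻ (edges (long (suc zero))) e∈″
  ... | inj₁ e∈₂ = ∈-edges⁻ (long (suc zero)) e∈₂
  ... | inj₂ e∈₃ = ∈-edges⁻ (long (suc (suc zero))) e∈₃

  basketEdge⁺ : ∀ p {t} → t < len p → (index (p , t) , index (p , suc t)) ∈ basketEdges k
  basketEdge⁺ short                   (s≤s t≤) = ∈-++⁺ˡ (∈-pathEdges⁺ 0 1 _ _ t≤)
  basketEdge⁺ (long zero)             (s≤s t≤) = ∈-++⁺ʳ (edges short) (∈-++⁺ˡ (∈-pathEdges⁺ 0 1 _ _ t≤))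
  basketEdge⁺ (long (suc zero))       (s≤s t≤) =
    ∈-++⁺ʳ (edges short) (∈-++⁺ʳ (edges (long zero)) (∈-++⁺ˡ (∈-pathEdges⁺ 0 1 _ _ t≤)))
  basketEdge⁺ (long (suc (suc zero))) (s≤s t≤) =
    ∈-++⁺ʳ (edges short) (∈-++⁺ʳ (edges (long zero)) (∈-++⁺ʳ (edges (long (suc zero))) (∈-pathEdges⁺ 0 1 _ _ t≤)))

  1<n : 1 < n
  1<n = subst (1 <_) (sym n≡) (s≤s (s≤s z≤n))

  inner-bound : ∀ p {t} → t < inner p → start p + t < n
  inner-bound short    {t} t<M = subst (2 + t <_) (sym n≡) (s≤s (s≤s (ℕP.m≤n⇒m≤n+o (3 * N) t<M)))
  inner-bound (long i) {t} t<N = subst₂ _<_ (sym (start-long i t)) (sym n≡)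
    (s≤s (s≤s (ℕP.+-monoʳ-< M (ℕP.<-≤-trans (ℕP.+-monoˡ-< (toℕ i * N) t<N) (ℕP.*-monoˡ-≤ N (FinP.toℕ<n i))))))

  index-bound : ∀ p {t} → t ≤ len p → index (p , t) < n
  index-bound p {zero}  _        = ℕP.<-trans (s≤s z≤n) 1<n
  index-bound p {suc t} (s≤s t≤) with ℕP.m≤n⇒m<n∨m≡n t≤
  ... | inj₁ t<inner = subst (_< n) (sym (index-inner p t<inner)) (inner-bound p t<inner)
  ... | inj₂ refl    = subst (_< n) (sym (index-last p)) 1<n

  -- Defs.basketEdges numbers the hubs first, then the inner vertices path by path.
  decode : ℕ → Coord
  decode 0             = short , 0
  decode 1             = short , N
  decode (suc (suc x)) = if does (x <? M) then (short , suc x) else (long (block (y ℕ./ N)) , suc (y ℕ.% N))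
    where y = x ∸ M

  /-block : ∀ (i : Fin 3) {t} → t < N → (t + toℕ i * N) ℕ./ N ≡ toℕ i
  /-block i {t} t<N = begin
    (t + toℕ i * N) ℕ./ N           ≡⟨ ℕD.+-distrib-/ t (toℕ i * N) no-carry ⟩
    t ℕ./ N + toℕ i * N ℕ./ N       ≡⟨ cong₂ _+_ (ℕD.m<n⇒m/n≡0 t<N) (ℕD.m*n/n≡m (toℕ i) N) ⟩
    toℕ i                           ∎
    where
    open ≡-Reasoning
    no-carry : t ℕ.% N + toℕ i * N ℕ.% N < N
    no-carry = subst₂ (λ a b → a + b < N) (sym (ℕD.m<n⇒m%n≡m t<N)) (sym (ℕD.m*n%n≡0 (toℕ i) N))
                      (subst (_< N) (sym (ℕP.+-identityʳ t)) t<N)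

  %-block : ∀ (i : Fin 3) {t} → t < N → (t + toℕ i * N) ℕ.% N ≡ t
  %-block i {t} t<N = trans (ℕD.[m+kn]%n≡m%n t (toℕ i) N) (ℕD.m<n⇒m%n≡m t<N)

  decode-long : ∀ y → decode (2 + (M + y)) ≡ (long (block (y ℕ./ N)) , suc (y ℕ.% N))
  decode-long y rewrite dec-false ((M + y) <? M) (ℕP.≤⇒≯ (ℕP.m≤m+n M y)) | ℕP.m+n∸m≡n M y = refl

  decode-inner : ∀ p {t} → t < inner p → decode (start p + t) ≡ (p , suc t)
  decode-inner short    {t} t<M rewrite dec-true (t <? M) t<M = refl
  decode-inner (long i) {t} t<N = begin
    decode (start (long i) + t)                        ≡⟨ cong decode (start-long i t) ⟩
    decode (2 + (M + (t + toℕ i * N)))                 ≡⟨ decode-long (t + toℕ i * N) ⟩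
    long (block ((t + toℕ i * N) ℕ./ N)) , suc ((t + toℕ i * N) ℕ.% N)
      ≡⟨ cong₂ (λ j u → long (block j) , suc u) (/-block i t<N) (%-block i t<N) ⟩
    long (block (toℕ i)) , suc t                       ≡⟨ cong (λ j → long j , suc t) (block-toℕ i) ⟩
    long i , suc t                                     ∎
    where open ≡-Reasoning

  data Located : ℕ → Set where
    hub₀   : Located 0
    hub₁   : Located 1
    inside : ∀ p {t} → t < inner p → Located (start p + t)

  locate : ∀ {x} → x < n → Located x
  locate {zero}        _   = hub₀
  locate {suc zero}    _   = hub₁
  locate {suc (suc x)} x<n with x <? M
  ... | yes x<M = inside short x<M
  ... | no  x≮M = subst Located located (inside (long i) (ℕD.m%n<n y N))
    where
    y = x ∸ M
    M+y≡x : M + y ≡ x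
    M+y≡x = ℕP.m+[n∸m]≡n (ℕP.≮⇒≥ x≮M)
    y<3N : y < 3 * N
    y<3N = ℕP.+-cancelˡ-< M y (3 * N) (subst (_< M + 3 * N) (sym M+y≡x) (ℕP.≤-pred (ℕP.≤-pred (subst (suc (suc (suc x)) ≤_) n≡ x<n))))
    i : Fin 3
    i = fromℕ< (ℕD.m<n*o⇒m/o<n y<3N)
    located : start (long i) + y ℕ.% N ≡ suc (suc x)
    located = begin
      start (long i) + y ℕ.% N                   ≡⟨ start-long i (y ℕ.% N) ⟩
      2 + (M + (y ℕ.% N + toℕ i * N))            ≡⟨ cong (λ j → 2 + (M + (y ℕ.% N + j * N))) (FinP.toℕ-fromℕ< (ℕD.m<n*o⇒m/o<n y<3N)) ⟩
      2 + (M + (y ℕ.% N + y ℕ./ N * N))          ≡⟨ cong (λ z → 2 + (M + z)) (sym (ℕD.m≡m%n+[m/n]*n y N)) ⟩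
      2 + (M + y)                                ≡⟨ cong (λ z → 2 + z) M+y≡x ⟩
      suc (suc x)                                ∎
      where open ≡-Reasoning

  -- Canonical coordinates: hubs on the short path, inner vertices strictly inside their path.
  Canonical : Coord → Set
  Canonical (p , t) = t ≤ N × len p ∸ t ≤ N

  decode-located : ∀ {x} → Located x → Canonical (decode x) × index (decode x) ≡ x
  decode-located hub₀ = (z≤n , ℕP.≤-refl) , refl
  decode-located hub₁ = (ℕP.≤-refl , subst (_≤ N) (sym (ℕP.n∸n≡0 N)) z≤n) , index-last short
  decode-located (inside p {t} t<) rewrite decode-inner p t< = (canonical p t< , index-inner p t<)
    where
    canonical : ∀ p → t < inner p → Canonical (p , suc t)
    canonical short    t<M = ℕP.<⇒≤ (s≤s t<M) , ℕP.m∸n≤m N (suc t)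
    canonical (long _) t<N = t<N , ℕP.m∸n≤m N t

  N≤len : ∀ p → N ≤ len p
  N≤len short    = ℕP.≤-refl
  N≤len (long _) = ℕP.n≤1+n N

  canonical-≤len : ∀ {c} → Canonical c → proj₂ c ≤ len (proj₁ c)
  canonical-≤len {p , _} (t≤N , _) = ℕP.≤-trans t≤N (N≤len p)

  dist : Coord → Coord → ℕ
  dist (p , t) (q , u) = if does (p ≟ᴾ q) then ∣ t - u ∣ else (t + u) ⊓ ((len p ∸ t) + (len q ∸ u))

  dist-same : ∀ p t u → dist (p , t) (p , u) ≡ ∣ t - u ∣
  dist-same p t u rewrite dec-true (p ≟ᴾ p) refl = refl

  dist-other : ∀ {p q} → p ≢ q → ∀ t u → dist (p , t) (q , u) ≡ (t + u) ⊓ ((len p ∸ t) + (len q ∸ u))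
  dist-other {p} {q} p≢q t u rewrite dec-false (p ≟ᴾ q) p≢q = refl

  dist-comm : ∀ c c′ → dist c c′ ≡ dist c′ c
  dist-comm (p , t) (q , u) with p ≟ᴾ q
  ... | yes refl = trans (ℕP.∣-∣-comm t u) (sym (dist-same p u t))
  ... | no  p≢q  = trans (cong₂ _⊓_ (ℕP.+-comm t u) (ℕP.+-comm (len p ∸ t) (len q ∸ u)))
                         (sym (dist-other (λ q≡p → p≢q (sym q≡p)) u t))

  dist-from-hub₀ : ∀ p {c} → Canonical c → dist (p , 0) c ≡ proj₂ c
  dist-from-hub₀ p {q , u} (u≤N , _) with p ≟ᴾ q
  ... | yes refl = refl
  ... | no  p≢q  = ℕP.m≤n⇒m⊓n≡m (ℕP.≤-trans u≤N (ℕP.≤-trans (N≤len p) (ℕP.m≤m+n (len p) _)))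

  dist-from-hub₁ : ∀ p {c} → Canonical c → dist (p , len p) c ≡ len (proj₁ c) ∸ proj₂ c
  dist-from-hub₁ p {q , u} c-canonical@(_ , L∸u≤N) with p ≟ᴾ q
  ... | yes refl = ℕP.m≤n⇒∣n-m∣≡n∸m (canonical-≤len c-canonical)
  ... | no  p≢q  = trans (cong (λ z → (len p + u) ⊓ (z + (len q ∸ u))) (ℕP.n∸n≡0 (len p)))
                         (ℕP.m≥n⇒m⊓n≡n (ℕP.≤-trans L∸u≤N (ℕP.≤-trans (N≤len p) (ℕP.m≤m+n (len p) u))))

  dist-decode-index : ∀ p {t} → t ≤ len p → ∀ {c} → Canonical c → dist (decode (index (p , t))) c ≡ dist (p , t) c
  dist-decode-index p {zero}  _        c-canonical = trans (dist-from-hub₀ short c-canonical) (sym (dist-from-hub₀ p c-canonical))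
  dist-decode-index p {suc t} (s≤s t≤) {c} c-canonical with ℕP.m≤n⇒m<n∨m≡n t≤
  ... | inj₁ t<inner = cong (λ c′ → dist c′ c) (trans (cong decode (index-inner p t<inner)) (decode-inner p t<inner))
  ... | inj₂ refl    = trans (cong (λ x → dist (decode x) c) (index-last p))
                             (trans (dist-from-hub₁ short c-canonical) (sym (dist-from-hub₁ p c-canonical)))

  ∣-∣-≤-suc-left : ∀ t u → ∣ t - u ∣ ≤ suc ∣ suc t - u ∣
  ∣-∣-≤-suc-left zero    zero    = z≤n
  ∣-∣-≤-suc-left zero    (suc u) = ℕP.≤-refl
  ∣-∣-≤-suc-left (suc t) zero    = ℕP.≤-trans (ℕP.n≤1+n _) (ℕP.n≤1+n _)
  ∣-∣-≤-suc-left (suc t) (suc u) = ∣-∣-≤-suc-left t u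

  ∣-suc-∣-≤-suc : ∀ t u → ∣ suc t - u ∣ ≤ suc ∣ t - u ∣
  ∣-suc-∣-≤-suc zero    zero    = s≤s z≤n
  ∣-suc-∣-≤-suc zero    (suc u) = ℕP.≤-trans (ℕP.n≤1+n u) (ℕP.n≤1+n _)
  ∣-suc-∣-≤-suc (suc t) zero    = ℕP.≤-refl
  ∣-suc-∣-≤-suc (suc t) (suc u) = ∣-suc-∣-≤-suc t u

  dist-step : ∀ p {t} → t < len p → ∀ c → dist (p , t) c ≤ suc (dist (p , suc t) c) × dist (p , suc t) c ≤ suc (dist (p , t) c)
  dist-step p {t} (s≤s t≤) (q , u) with p ≟ᴾ q
  ... | yes refl = ∣-∣-≤-suc-left t u , ∣-suc-∣-≤-suc t u
  ... | no  p≢q  rewrite ℕP.+-∸-assoc 1 t≤ =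
    ℕP.⊓-mono-≤ (ℕP.≤-trans (ℕP.n≤1+n _) (ℕP.n≤1+n _)) ℕP.≤-refl , ℕP.⊓-mono-≤ ℕP.≤-refl (ℕP.≤-trans (ℕP.n≤1+n _) (ℕP.n≤1+n _))

  at : ∀ p {t} → .(t ≤ len p) → Fin n
  at p t≤ = fromℕ< (index-bound p t≤)

  toℕ-at : ∀ p {t} (t≤ : t ≤ len p) → toℕ (at p t≤) ≡ index (p , t)
  toℕ-at p t≤ = FinP.toℕ-fromℕ< (index-bound p t≤)

  at-cong : ∀ p {t u} (t≤ : t ≤ len p) (u≤ : u ≤ len p) → t ≡ u → at p t≤ ≡ at p u≤
  at-cong p _ _ refl = refl

  at-hub₁ : ∀ p q → at p (ℕP.≤-refl {len p}) ≡ at q (ℕP.≤-refl {len q})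
  at-hub₁ p q = FinP.toℕ-injective (trans (toℕ-at p ℕP.≤-refl) (trans (index-last p) (sym (trans (toℕ-at q ℕP.≤-refl) (index-last q)))))

  at-edge : ∀ p {t} (t< : t < len p) → Basket k (at p (ℕP.<⇒≤ t<)) (at p t<)
  at-edge p t< = inj₁ (subst₂ (λ a b → (a , b) ∈ basketEdges k) (sym (toℕ-at p (ℕP.<⇒≤ t<))) (sym (toℕ-at p t<)) (basketEdge⁺ p t<))

  forward : ∀ p t d (t+d≤ : t + d ≤ len p) → Walk (Basket k) (at p (ℕP.m+n≤o⇒m≤o t t+d≤)) (at p t+d≤) d
  forward p t zero    t+d≤ = subst (λ a → Walk (Basket k) (at p t≤) a 0) (at-cong p t≤ t+d≤ (sym (ℕP.+-identityʳ t))) nil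
    where t≤ = ℕP.m+n≤o⇒m≤o t t+d≤
  forward p t (suc d) t+d≤ =
    cons (at-edge p t<) (subst (λ a → Walk (Basket k) (at p t<) a d) (at-cong p t+d≤′ t+d≤ (sym (ℕP.+-suc t d))) (forward p (suc t) d t+d≤′))
    where
    t+d≤′ : suc t + d ≤ len p
    t+d≤′ = subst (_≤ len p) (ℕP.+-suc t d) t+d≤
    t< : t < len p
    t< = ℕP.m+n≤o⇒m≤o (suc t) t+d≤′

  along : ∀ p {t u} (t≤ : t ≤ len p) (u≤ : u ≤ len p) → Walk (Basket k) (at p t≤) (at p u≤) ∣ t - u ∣
  along p {t} {u} t≤ u≤ with ℕP.≤-total t u
  ... | inj₁ t≤u with ℕP.m≤n⇒∃[o]m+o≡n t≤u
  ...   | d , refl = subst (Walk (Basket k) _ _) (sym (ℕP.∣m-m+n∣≡n t d)) (forward p t d u≤)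
  along p {t} {u} t≤ u≤ | inj₂ u≤t with ℕP.m≤n⇒∃[o]m+o≡n u≤t
  ...   | d , refl = subst (Walk (Basket k) _ _) (sym (trans (ℕP.∣-∣-comm (u + d) u) (ℕP.∣m-m+n∣≡n u d)))
                           (walk-reverse swap (forward p u d t≤))

  dist-walk : ∀ p q {t u} (t≤ : t ≤ len p) (u≤ : u ≤ len q) → Walk (Basket k) (at p t≤) (at q u≤) (dist (p , t) (q , u))
  dist-walk p q {t} {u} t≤ u≤ with p ≟ᴾ q
  ... | yes refl = along p t≤ u≤
  ... | no  p≢q  with ℕP.⊓-sel (t + u) ((len p ∸ t) + (len q ∸ u))
  ...   | inj₁ via-hub₀ = subst (Walk (Basket k) _ _) (trans (cong (_+ u) (ℕP.∣-∣-identityʳ t)) (sym via-hub₀))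
                                (along p t≤ z≤n ++ʷ along q z≤n u≤)
  ...   | inj₂ via-hub₁ = subst (Walk (Basket k) _ _) (trans (cong₂ _+_ (ℕP.m≤n⇒∣m-n∣≡n∸m t≤) (ℕP.m≤n⇒∣n-m∣≡n∸m u≤)) (sym via-hub₁))
                                (along p t≤ ℕP.≤-refl ++ʷ subst (λ a → Walk (Basket k) a (at q u≤) _) (at-hub₁ q p) (along q ℕP.≤-refl u≤))

  decode-canonical : ∀ (a : Fin n) → Canonical (decode (toℕ a))
  decode-canonical a = proj₁ (decode-located (locate (FinP.toℕ<n a)))

  at-decode : ∀ (a : Fin n) → at (proj₁ (decode (toℕ a))) (canonical-≤len (decode-canonical a)) ≡ a
  at-decode a = FinP.toℕ-injective (trans (toℕ-at _ (canonical-≤len (decode-canonical a))) (proj₂ (decode-located (locate (FinP.toℕ<n a)))))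

  D : Fin n → Fin n → ℕ
  D a b = dist (decode (toℕ a)) (decode (toℕ b))

  -- The distance formula itself is the potential certifying minimality.
  D-isDistanceMatrix : IsDistanceMatrix (Basket k) D
  D-isDistanceMatrix a b = IsDistance-by-potential (λ x → D x b) edge-step refl D-bb walk
    where
    c = decode (toℕ b)
    walk : Walk (Basket k) a b (D a b)
    walk = subst₂ (λ x y → Walk (Basket k) x y (D a b)) (at-decode a) (at-decode b)
                  (dist-walk _ _ (canonical-≤len (decode-canonical a)) (canonical-≤len (decode-canonical b)))
    D-bb : D b b ≡ 0
    D-bb = trans (dist-same (proj₁ c) (proj₂ c) (proj₂ c)) (ℕP.∣n-n∣≡0 (proj₂ c))
    D-at : ∀ x p {t} → toℕ x ≡ index (p , t) → t ≤ len p → D x b ≡ dist (p , t) c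
    D-at x p x≡ t≤ = trans (cong (λ i → dist (decode i) c) x≡) (dist-decode-index p t≤ (decode-canonical b))
    edge-step : ∀ {x y} → Basket k x y → D x b ≤ suc (D y b)
    edge-step {x} {y} (inj₁ xy∈) with basketEdge⁻ xy∈
    ... | p , t , t< , xy≡ = subst₂ (λ d d′ → d ≤ suc d′) (sym (D-at x p (cong proj₁ xy≡) (ℕP.<⇒≤ t<))) (sym (D-at y p (cong proj₂ xy≡) t<))
                                    (proj₁ (dist-step p t< c))
    edge-step {x} {y} (inj₂ yx∈) with basketEdge⁻ yx∈
    ... | p , t , t< , yx≡ = subst₂ (λ d d′ → d ≤ suc d′) (sym (D-at x p (cong proj₂ yx≡) t<)) (sym (D-at y p (cong proj₁ yx≡) (ℕP.<⇒≤ t<)))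
                                    (proj₂ (dist-step p t< c))

-- A distance certificate for the basket

ω : ℤ
ω = ℤ.- + 3

module BasketWeights (M : ℕ) where

  open BasketGraph M

  shortWeight longWeight : ℕ → ℤ
  shortWeight t = ω ℤ.^ (N ∸ t) ℤ.+ ω ℤ.^ t
  longWeight  t = ω ℤ.^ (M ∸ t) ℤ.+ ω ℤ.^ t

  -- (-3)^d(v,hub₁) + (-3)^d(v,hub₀), both distances lowered by one on the long paths.
  weight : Coord → ℤ
  weight (short  , t) = shortWeight t
  weight (long _ , t) = longWeight (t ∸ 1)

  vertexSum : (Coord → ℤ) → ℤ
  vertexSum F = ∑ℕ (suc N) (λ t → F (short , t)) ℤ.+ ∑[ i < 3 ] ∑ℕ N (λ t → F (long i , suc t))

  ∑-vertices : ∀ F → ∑[ a < n ] F (decode (toℕ a)) ≡ vertexSum F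
  ∑-vertices F = begin
    ∑ℕ n (λ x → F (decode x))
      ≡⟨ cong (λ m → ∑ℕ m (λ x → F (decode x))) n≡ ⟩
    F (short , 0) ℤ.+ (F (short , N) ℤ.+ ∑ℕ (M + 3 * N) (λ x → F (decode (2 + x))))
      ≡⟨ cong (λ s → F (short , 0) ℤ.+ (F (short , N) ℤ.+ s)) (∑ℕ-split M (3 * N) (λ x → F (decode (2 + x)))) ⟩
    F (short , 0) ℤ.+ (F (short , N) ℤ.+ (∑ℕ M (λ x → F (decode (2 + x))) ℤ.+ ∑ℕ (3 * N) (λ y → F (decode (2 + (M + y))))))
      ≡⟨ cong₂ (λ s l → F (short , 0) ℤ.+ (F (short , N) ℤ.+ (s ℤ.+ l))) short-inner long-inner ⟩
    F (short , 0) ℤ.+ (F (short , N) ℤ.+ (∑ℕ M (λ t → F (short , suc t)) ℤ.+ L))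
      ≡⟨ regroup (F (short , 0)) (F (short , N)) (∑ℕ M (λ t → F (short , suc t))) L ⟩
    F (short , 0) ℤ.+ (∑ℕ M (λ t → F (short , suc t)) ℤ.+ F (short , N)) ℤ.+ L
      ≡⟨ cong (λ s → F (short , 0) ℤ.+ s ℤ.+ L) (sym (∑ℕ-last M (λ t → F (short , suc t)))) ⟩
    vertexSum F ∎
    where
    open ≡-Reasoning
    L = ∑[ i < 3 ] ∑ℕ N (λ t → F (long i , suc t))
    short-inner : ∑ℕ M (λ x → F (decode (2 + x))) ≡ ∑ℕ M (λ t → F (short , suc t))
    short-inner = ∑ℕ-cong M (λ t t<M → cong F (decode-inner short t<M))
    long-inner : ∑ℕ (3 * N) (λ y → F (decode (2 + (M + y)))) ≡ L
    long-inner = trans (∑ℕ-blocks 3 N (λ y → F (decode (2 + (M + y)))))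
      (sum-cong-≗ (λ i → ∑ℕ-cong N (λ t t<N → cong F (trans (cong decode (trans (cong (λ y → 2 + (M + y)) (ℕP.+-comm (toℕ i * N) t)) (sym (start-long i t))))
                                                               (decode-inner (long i) t<N)))))
    regroup : ∀ a b c d → a ℤ.+ (b ℤ.+ (c ℤ.+ d)) ≡ a ℤ.+ (c ℤ.+ b) ℤ.+ d
    regroup = solve-∀

  vertexSum-cong : ∀ {F G} → (∀ v → Canonical v → F v ≡ G v) → vertexSum F ≡ vertexSum G
  vertexSum-cong F≡G = cong₂ ℤ._+_
    (∑ℕ-cong (suc N) (λ t t<1+N → F≡G (short , t) (ℕP.≤-pred t<1+N , ℕP.m∸n≤m N t)))
    (sum-cong-≗ (λ i → ∑ℕ-cong N (λ t t<N → F≡G (long i , suc t) (t<N , ℕP.m∸n≤m N t))))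

  vertexSum-+ : ∀ F G → vertexSum (λ v → F v ℤ.+ G v) ≡ vertexSum F ℤ.+ vertexSum G
  vertexSum-+ F G = begin
    vertexSum (λ v → F v ℤ.+ G v)
      ≡⟨ cong₂ ℤ._+_ (∑ℕ-+ (suc N) (λ t → F (short , t)) (λ t → G (short , t)))
                     (trans (sum-cong-≗ (λ i → ∑ℕ-+ N (λ t → F (long i , suc t)) (λ t → G (long i , suc t))))
                            (∑-distrib-+ (λ i → ∑ℕ N (λ t → F (long i , suc t))) (λ i → ∑ℕ N (λ t → G (long i , suc t))))) ⟩
    (a ℤ.+ b) ℤ.+ (c ℤ.+ d)
      ≡⟨ interchange a b c d ⟩
    vertexSum F ℤ.+ vertexSum G ∎
    where
    open ≡-Reasoning
    a = ∑ℕ (suc N) (λ t → F (short , t))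
    b = ∑ℕ (suc N) (λ t → G (short , t))
    c = ∑[ i < 3 ] ∑ℕ N (λ t → F (long i , suc t))
    d = ∑[ i < 3 ] ∑ℕ N (λ t → G (long i , suc t))
    interchange : ∀ a b c d → (a ℤ.+ b) ℤ.+ (c ℤ.+ d) ≡ (a ℤ.+ c) ℤ.+ (b ℤ.+ d)
    interchange = solve-∀

  vertexSum-* : ∀ c F → vertexSum (λ v → c ℤ.* F v) ≡ c ℤ.* vertexSum F
  vertexSum-* c F = begin
    vertexSum (λ v → c ℤ.* F v)
      ≡⟨ cong₂ ℤ._+_ (∑ℕ-* (suc N) c (λ t → F (short , t)))
                     (trans (sum-cong-≗ (λ i → ∑ℕ-* N c (λ t → F (long i , suc t))))
                            (sym (*-distribˡ-sum c (λ i → ∑ℕ N (λ t → F (long i , suc t)))))) ⟩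
    c ℤ.* ∑ℕ (suc N) (λ t → F (short , t)) ℤ.+ c ℤ.* ∑[ i < 3 ] ∑ℕ N (λ t → F (long i , suc t))
      ≡⟨ sym (ℤP.*-distribˡ-+ c _ _) ⟩
    c ℤ.* vertexSum F ∎
    where open ≡-Reasoning

  vertexSum-Δ² : ∀ (f : Coord → ℕ → ℤ) x →
                 Δ² (λ X → vertexSum (λ v → weight v ℤ.* f v X)) x ≡ vertexSum (λ v → weight v ℤ.* Δ² (f v) x)
  vertexSum-Δ² f x = begin
    s₂ ℤ.- + 2 ℤ.* s₁ ℤ.+ s₀
      ≡⟨ cong (λ z → z ℤ.+ s₀) (cong (ℤ._+_ s₂) (trans (ℤP.neg-distribˡ-* (+ 2) s₁) (sym (vertexSum-* (ℤ.- + 2) (λ v → weight v ℤ.* f v (suc x)))))) ⟩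
    s₂ ℤ.+ vertexSum (λ v → ℤ.- + 2 ℤ.* (weight v ℤ.* f v (suc x))) ℤ.+ s₀
      ≡⟨ cong (ℤ._+ s₀) (sym (vertexSum-+ (λ v → weight v ℤ.* f v (suc (suc x))) (λ v → ℤ.- + 2 ℤ.* (weight v ℤ.* f v (suc x))))) ⟩
    vertexSum (λ v → weight v ℤ.* f v (suc (suc x)) ℤ.+ ℤ.- + 2 ℤ.* (weight v ℤ.* f v (suc x))) ℤ.+ s₀
      ≡⟨ sym (vertexSum-+ (λ v → weight v ℤ.* f v (suc (suc x)) ℤ.+ ℤ.- + 2 ℤ.* (weight v ℤ.* f v (suc x))) (λ v → weight v ℤ.* f v x)) ⟩
    vertexSum (λ v → weight v ℤ.* f v (suc (suc x)) ℤ.+ ℤ.- + 2 ℤ.* (weight v ℤ.* f v (suc x)) ℤ.+ weight v ℤ.* f v x)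
      ≡⟨ vertexSum-cong (λ v _ → factor (weight v) (f v (suc (suc x))) (f v (suc x)) (f v x)) ⟩
    vertexSum (λ v → weight v ℤ.* Δ² (f v) x) ∎
    where
    open ≡-Reasoning
    s₂ = vertexSum (λ v → weight v ℤ.* f v (suc (suc x)))
    s₁ = vertexSum (λ v → weight v ℤ.* f v (suc x))
    s₀ = vertexSum (λ v → weight v ℤ.* f v x)
    factor : ∀ w a b c → w ℤ.* a ℤ.+ ℤ.- + 2 ℤ.* (w ℤ.* b) ℤ.+ w ℤ.* c ≡ w ℤ.* (a ℤ.- + 2 ℤ.* b ℤ.+ c)
    factor = solve-∀

  vertexSum-Δ : ∀ (f : Coord → ℕ → ℤ) x →
                Δ (λ X → vertexSum (λ v → weight v ℤ.* f v X)) x ≡ vertexSum (λ v → weight v ℤ.* Δ (f v) x)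
  vertexSum-Δ f x = begin
    s₁ ℤ.- s₀
      ≡⟨ cong (ℤ._+_ s₁) (trans (sym (ℤP.-1*i≡-i s₀)) (sym (vertexSum-* ℤ.-1ℤ (λ v → weight v ℤ.* f v x)))) ⟩
    s₁ ℤ.+ vertexSum (λ v → ℤ.-1ℤ ℤ.* (weight v ℤ.* f v x))
      ≡⟨ sym (vertexSum-+ (λ v → weight v ℤ.* f v (suc x)) (λ v → ℤ.-1ℤ ℤ.* (weight v ℤ.* f v x))) ⟩
    vertexSum (λ v → weight v ℤ.* f v (suc x) ℤ.+ ℤ.-1ℤ ℤ.* (weight v ℤ.* f v x))
      ≡⟨ vertexSum-cong (λ v _ → factor (weight v) (f v (suc x)) (f v x)) ⟩
    vertexSum (λ v → weight v ℤ.* Δ (f v) x) ∎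
    where
    open ≡-Reasoning
    s₁ = vertexSum (λ v → weight v ℤ.* f v (suc x))
    s₀ = vertexSum (λ v → weight v ℤ.* f v x)
    factor : ∀ w a b → w ℤ.* a ℤ.+ ℤ.-1ℤ ℤ.* (w ℤ.* b) ≡ w ℤ.* (a ℤ.- b)
    factor = solve-∀

  column : Coord → ℤ
  column c = vertexSum (λ v → weight v ℤ.* + dist v c)

  Δ²-same : ∀ p t x → Δ² (λ X → + dist (p , t) (p , X)) x ≡ + 0 ℤ.+ pointMasses ((+ 2 , suc x) ∷ []) t
  Δ²-same p t x = trans (Δ²-cong x (λ X → cong +_ (dist-same p t X))) (trans (∣-∣-Δ² t x) (padding (δ t (suc x))))
    where
    padding : ∀ d → + 2 ℤ.* d ≡ + 0 ℤ.+ (+ 2 ℤ.* d ℤ.+ + 0)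
    padding = solve-∀

  Δ-same : ∀ p t → Δ (λ X → + dist (p , t) (p , X)) 0 ≡ ℤ.-1ℤ ℤ.+ pointMasses ((+ 2 , 0) ∷ []) t
  Δ-same p t = trans (Δ-cong 0 (λ X → cong +_ (dist-same p t X))) (trans (∣-∣-Δ t) (padding (δ t 0)))
    where
    padding : ∀ d → ℤ.-1ℤ ℤ.+ + 2 ℤ.* d ≡ ℤ.-1ℤ ℤ.+ (+ 2 ℤ.* d ℤ.+ + 0)
    padding = solve-∀

  dist-cross : ∀ {p q} → p ≢ q → ∀ t X → + dist (p , t) (q , X) ≡ crossProfile t (len p ∸ t) (len q) X
  dist-cross p≢q t X = cong +_ (dist-other p≢q t X)

  long≢short : ∀ {i} → long i ≢ short
  long≢short ()

  short≢long : ∀ {i} → short ≢ long i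
  short≢long ()

  private
    N+N≡1+N+M : N + N ≡ suc N + M
    N+N≡1+N+M = cong suc (ℕP.+-suc M M)

    1+t+[N∸t]≡1+N : ∀ {t} → t ≤ N → suc t + (N ∸ t) ≡ suc N
    1+t+[N∸t]≡1+N t≤N = cong suc (ℕP.m+[n∸m]≡n t≤N)

  module _ (X r : ℕ) (X+r : 2 + X + r ≡ N) where

    private
      N≡ : N ≡ X + suc (suc r)
      N≡ = trans (sym X+r) (sym (trans (ℕP.+-suc X (suc r)) (cong suc (ℕP.+-suc X r))))

      1+N≡ : suc N ≡ X + suc (suc (suc r))
      1+N≡ = trans (cong suc N≡) (sym (ℕP.+-suc X (suc (suc r))))

    Δ²-long-to-short : ∀ i t → t < N →
      Δ² (λ Y → + dist (long i , suc t) (short , Y)) X ≡ + 0 ℤ.+ pointMasses ((ℤ.-1ℤ , r) ∷ (ℤ.-1ℤ , suc r) ∷ []) t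
    Δ²-long-to-short i t t<N = begin
      Δ² (λ Y → + dist (long i , suc t) (short , Y)) X
        ≡⟨ Δ²-cong X (dist-cross (long≢short {i}) (suc t)) ⟩
      Δ² (crossProfile (suc t) (N ∸ t) N) X
        ≡⟨ cong (λ ℓ → Δ² (crossProfile (suc t) (N ∸ t) ℓ) X) N≡ ⟩
      Δ² (crossProfile (suc t) (N ∸ t) (X + suc (suc r))) X
        ≡⟨ crossProfile-Δ²-odd {a = suc t} {b = N ∸ t} {s = suc r} (1+t+[N∸t]≡1+N (ℕP.<⇒≤ t<N)) (trans (cong (λ l → suc l + r) N≡) (shift X r)) ⟩
      ℤ.- (δ t r ℤ.+ δ t (suc r))
        ≡⟨ padding (δ t r) (δ t (suc r)) ⟩
      + 0 ℤ.+ pointMasses ((ℤ.-1ℤ , r) ∷ (ℤ.-1ℤ , suc r) ∷ []) t ∎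
      where
      open ≡-Reasoning
      shift : ∀ X r → suc (X + suc (suc r)) + r ≡ X + suc (suc r + suc r)
      shift = ℕSolver.solve-∀
      padding : ∀ a b → ℤ.- (a ℤ.+ b) ≡ + 0 ℤ.+ (ℤ.-1ℤ ℤ.* a ℤ.+ (ℤ.-1ℤ ℤ.* b ℤ.+ + 0))
      padding = solve-∀

    Δ²-short-to-long : ∀ i t → t < suc N →
      Δ² (λ Y → + dist (short , t) (long i , Y)) X ≡ + 0 ℤ.+ pointMasses ((ℤ.-1ℤ , suc r) ∷ (ℤ.-1ℤ , suc (suc r)) ∷ []) t
    Δ²-short-to-long i t t<1+N = begin
      Δ² (λ Y → + dist (short , t) (long i , Y)) X
        ≡⟨ Δ²-cong X (dist-cross (short≢long {i}) t) ⟩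
      Δ² (crossProfile t (N ∸ t) (suc N)) X
        ≡⟨ cong (λ ℓ → Δ² (crossProfile t (N ∸ t) ℓ) X) 1+N≡ ⟩
      Δ² (crossProfile t (N ∸ t) (X + suc (suc (suc r)))) X
        ≡⟨ crossProfile-Δ²-odd {a = t} {b = N ∸ t} {s = suc r} (ℕP.m+[n∸m]≡n (ℕP.≤-pred t<1+N)) (trans (cong (_+ suc r) N≡) (shift X r)) ⟩
      ℤ.- (δ t (suc r) ℤ.+ δ t (suc (suc r)))
        ≡⟨ padding (δ t (suc r)) (δ t (suc (suc r))) ⟩
      + 0 ℤ.+ pointMasses ((ℤ.-1ℤ , suc r) ∷ (ℤ.-1ℤ , suc (suc r)) ∷ []) t ∎
      where
      open ≡-Reasoning
      shift : ∀ X r → X + suc (suc r) + suc r ≡ X + suc (suc r + suc r)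
      shift = ℕSolver.solve-∀
      padding : ∀ a b → ℤ.- (a ℤ.+ b) ≡ + 0 ℤ.+ (ℤ.-1ℤ ℤ.* a ℤ.+ (ℤ.-1ℤ ℤ.* b ℤ.+ + 0))
      padding = solve-∀

    Δ²-long-to-other-long : ∀ {i j} → i ≢ j → ∀ t → t < N →
      Δ² (λ Y → + dist (long i , suc t) (long j , Y)) X ≡ + 0 ℤ.+ pointMasses ((ℤ.- + 2 , suc r) ∷ []) t
    Δ²-long-to-other-long {i} {j} i≢j t t<N = begin
      Δ² (λ Y → + dist (long i , suc t) (long j , Y)) X
        ≡⟨ Δ²-cong X (dist-cross (λ eq → i≢j (long-injective eq)) (suc t)) ⟩
      Δ² (crossProfile (suc t) (N ∸ t) (suc N)) X
        ≡⟨ cong (λ ℓ → Δ² (crossProfile (suc t) (N ∸ t) ℓ) X) 1+N≡ ⟩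
      Δ² (crossProfile (suc t) (N ∸ t) (X + suc (suc (suc r)))) X
        ≡⟨ crossProfile-Δ²-even {a = suc t} {b = N ∸ t} {s = suc (suc r)} (1+t+[N∸t]≡1+N (ℕP.<⇒≤ t<N)) (trans (cong (λ l → suc l + suc r) N≡) (shift X r)) ⟩
      ℤ.- (+ 2 ℤ.* δ t (suc r))
        ≡⟨ padding (δ t (suc r)) ⟩
      + 0 ℤ.+ pointMasses ((ℤ.- + 2 , suc r) ∷ []) t ∎
      where
      open ≡-Reasoning
      shift : ∀ X r → suc (X + suc (suc r)) + suc r ≡ X + (suc (suc r) + suc (suc r))
      shift = ℕSolver.solve-∀
      padding : ∀ a → ℤ.- (+ 2 ℤ.* a) ≡ + 0 ℤ.+ (ℤ.- + 2 ℤ.* a ℤ.+ + 0)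
      padding = solve-∀

  Δ-long-to-short : ∀ i t → t < N → Δ (λ Y → + dist (long i , suc t) (short , Y)) 0 ≡ + 1 ℤ.+ pointMasses ((ℤ.-1ℤ , M) ∷ []) t
  Δ-long-to-short i t t<N =
    trans (Δ-cong 0 (dist-cross (long≢short {i}) (suc t)))
          (trans (crossProfile-Δ-even {a = suc t} {b = N ∸ t} {s = N} (1+t+[N∸t]≡1+N (ℕP.<⇒≤ t<N)) (sym N+N≡1+N+M) (subst (suc t + suc t ≤_) N+N≡1+N+M (ℕP.+-mono-≤ t<N t<N)))
                 (padding (δ t M)))
    where
    padding : ∀ a → + 1 ℤ.- a ≡ + 1 ℤ.+ (ℤ.-1ℤ ℤ.* a ℤ.+ + 0)
    padding = solve-∀

  Δ-short-to-long : ∀ i t → t < suc N → Δ (λ Y → + dist (short , t) (long i , Y)) 0 ≡ + 1 ℤ.+ pointMasses ((ℤ.-1ℤ , N) ∷ []) t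
  Δ-short-to-long i t t<1+N =
    trans (Δ-cong 0 (dist-cross (short≢long {i}) t))
          (trans (crossProfile-Δ-even {a = t} {b = N ∸ t} {s = N} (ℕP.m+[n∸m]≡n t≤N) refl (ℕP.+-mono-≤ t≤N t≤N))
                 (padding (δ t N)))
    where
    t≤N = ℕP.≤-pred t<1+N
    padding : ∀ a → + 1 ℤ.- a ≡ + 1 ℤ.+ (ℤ.-1ℤ ℤ.* a ℤ.+ + 0)
    padding = solve-∀

  Δ-long-to-other-long : ∀ {i j} → i ≢ j → ∀ t → t < N → Δ (λ Y → + dist (long i , suc t) (long j , Y)) 0 ≡ + 1 ℤ.+ pointMasses [] t
  Δ-long-to-other-long i≢j t t<N =
    trans (Δ-cong 0 (dist-cross (λ eq → i≢j (long-injective eq)) (suc t)))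
          (trans (crossProfile-Δ-odd {a = suc t} {b = N ∸ t} {s = N} (1+t+[N∸t]≡1+N (ℕP.<⇒≤ t<N)) refl (ℕP.≤-trans (ℕP.+-mono-≤ t<N t<N) (ℕP.n≤1+n (N + N))))
                 (sym (ℤP.+-identityʳ (+ 1))))

  S₀ S₁ : ℤ
  S₀ = ∑ℕ (suc N) shortWeight
  S₁ = ∑ℕ N longWeight

  ∑-Fin3-one-two : ∀ (j : Fin 3) (f : Fin 3 → ℤ) {a b} → f j ≡ a → (∀ i → i ≢ j → f i ≡ b) → ∑[ i < 3 ] f i ≡ a ℤ.+ + 2 ℤ.* b
  ∑-Fin3-one-two zero             f {a} {b} fj others rewrite fj | others (suc zero) (λ ()) | others (suc (suc zero)) (λ ()) = lemma a b
    where
    lemma : ∀ a b → a ℤ.+ (b ℤ.+ (b ℤ.+ + 0)) ≡ a ℤ.+ + 2 ℤ.* b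
    lemma = solve-∀
  ∑-Fin3-one-two (suc zero)       f {a} {b} fj others rewrite fj | others zero (λ ()) | others (suc (suc zero)) (λ ()) = lemma a b
    where
    lemma : ∀ a b → b ℤ.+ (a ℤ.+ (b ℤ.+ + 0)) ≡ a ℤ.+ + 2 ℤ.* b
    lemma = solve-∀
  ∑-Fin3-one-two (suc (suc zero)) f {a} {b} fj others rewrite fj | others zero (λ ()) | others (suc zero) (λ ()) = lemma a b
    where
    lemma : ∀ a b → b ℤ.+ (b ℤ.+ (a ℤ.+ + 0)) ≡ a ℤ.+ + 2 ℤ.* b
    lemma = solve-∀

  column-Δ²-short : ∀ {X r} → 2 + X + r ≡ N →
               Δ² (λ Y → column (short , Y)) X ≡ + 2 ℤ.* shortWeight (suc X) ℤ.- + 3 ℤ.* (longWeight r ℤ.+ longWeight (suc r))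
  column-Δ²-short {X} {r} X+r = begin
    Δ² (λ Y → column (short , Y)) X
      ≡⟨ vertexSum-Δ² (λ v Y → + dist v (short , Y)) X ⟩
    vertexSum (λ v → weight v ℤ.* Δ² (λ Y → + dist v (short , Y)) X)
      ≡⟨ cong₂ ℤ._+_ (∑ℕ-affine (suc N) shortWeight (λ t → Δ² (λ Y → + dist (short , t) (short , Y)) X) (+ 0)
                                  ((+ 2 , suc X) ∷ []) (s≤s (ℕP.<⇒≤ 1+X<N) ∷ []) (λ t _ → Δ²-same short t X))
                     (sum-cong-≗ (λ i → ∑ℕ-affine N longWeight (λ t → Δ² (λ Y → + dist (long i , suc t) (short , Y)) X) (+ 0)
                                                    ((ℤ.-1ℤ , r) ∷ (ℤ.-1ℤ , suc r) ∷ []) (r<N ∷ 1+r<N ∷ []) (Δ²-long-to-short X r X+r i))) ⟩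
    (+ 0 ℤ.* S₀ ℤ.+ (+ 2 ℤ.* a ℤ.+ + 0)) ℤ.+ (T ℤ.+ (T ℤ.+ (T ℤ.+ + 0)))
      ≡⟨ collect S₀ S₁ a b c ⟩
    + 2 ℤ.* a ℤ.- + 3 ℤ.* (b ℤ.+ c) ∎
    where
    open ≡-Reasoning
    a = shortWeight (suc X)
    b = longWeight r
    c = longWeight (suc r)
    T = + 0 ℤ.* S₁ ℤ.+ (ℤ.-1ℤ ℤ.* b ℤ.+ (ℤ.-1ℤ ℤ.* c ℤ.+ + 0))
    1+X<N : suc X < N
    1+X<N = subst (suc X <_) X+r (s≤s (s≤s (ℕP.m≤m+n X r)))
    1+r<N : suc r < N
    1+r<N = subst (suc r <_) X+r (s≤s (s≤s (ℕP.m≤n+m r X)))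
    r<N = ℕP.<-trans (ℕP.n<1+n r) 1+r<N
    collect : ∀ s₀ s₁ a b c → let T = + 0 ℤ.* s₁ ℤ.+ (ℤ.-1ℤ ℤ.* b ℤ.+ (ℤ.-1ℤ ℤ.* c ℤ.+ + 0)) in
              (+ 0 ℤ.* s₀ ℤ.+ (+ 2 ℤ.* a ℤ.+ + 0)) ℤ.+ (T ℤ.+ (T ℤ.+ (T ℤ.+ + 0))) ≡ + 2 ℤ.* a ℤ.- + 3 ℤ.* (b ℤ.+ c)
    collect = solve-∀

  column-Δ²-long : ∀ j {X r} → 2 + X + r ≡ N →
              Δ² (λ Y → column (long j , Y)) X ≡ ℤ.- (shortWeight (suc r) ℤ.+ shortWeight (suc (suc r))) ℤ.+ + 2 ℤ.* longWeight X ℤ.- + 4 ℤ.* longWeight (suc r)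
  column-Δ²-long j {X} {r} X+r = begin
    Δ² (λ Y → column (long j , Y)) X
      ≡⟨ vertexSum-Δ² (λ v Y → + dist v (long j , Y)) X ⟩
    vertexSum (λ v → weight v ℤ.* Δ² (λ Y → + dist v (long j , Y)) X)
      ≡⟨ cong₂ ℤ._+_ (∑ℕ-affine (suc N) shortWeight (λ t → Δ² (λ Y → + dist (short , t) (long j , Y)) X) (+ 0)
                                  ((ℤ.-1ℤ , suc r) ∷ (ℤ.-1ℤ , suc (suc r)) ∷ []) (s≤s (ℕP.<⇒≤ 1+r<N) ∷ s≤s 1+r<N ∷ [])
                                  (Δ²-short-to-long X r X+r j))
                     (∑-Fin3-one-two j _ same-path other-path) ⟩
    (+ 0 ℤ.* S₀ ℤ.+ (ℤ.-1ℤ ℤ.* a ℤ.+ (ℤ.-1ℤ ℤ.* b ℤ.+ + 0)))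
      ℤ.+ ((+ 0 ℤ.* S₁ ℤ.+ (+ 2 ℤ.* c ℤ.+ + 0)) ℤ.+ + 2 ℤ.* (+ 0 ℤ.* S₁ ℤ.+ (ℤ.- + 2 ℤ.* d ℤ.+ + 0)))
      ≡⟨ collect S₀ S₁ a b c d ⟩
    ℤ.- (a ℤ.+ b) ℤ.+ + 2 ℤ.* c ℤ.- + 4 ℤ.* d ∎
    where
    open ≡-Reasoning
    a = shortWeight (suc r)
    b = shortWeight (suc (suc r))
    c = longWeight X
    d = longWeight (suc r)
    1+r<N : suc r < N
    1+r<N = subst (suc r <_) X+r (s≤s (s≤s (ℕP.m≤n+m r X)))
    X<N : X < N
    X<N = subst (X <_) X+r (s≤s (ℕP.≤-trans (ℕP.m≤m+n X r) (ℕP.n≤1+n _)))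
    same-path : ∑ℕ N (λ t → longWeight t ℤ.* Δ² (λ Y → + dist (long j , suc t) (long j , Y)) X) ≡ + 0 ℤ.* S₁ ℤ.+ (+ 2 ℤ.* c ℤ.+ + 0)
    same-path = ∑ℕ-affine N longWeight _ (+ 0) ((+ 2 , X) ∷ []) (X<N ∷ []) (λ t _ → Δ²-same (long j) (suc t) X)
    other-path : ∀ i → i ≢ j → ∑ℕ N (λ t → longWeight t ℤ.* Δ² (λ Y → + dist (long i , suc t) (long j , Y)) X) ≡ + 0 ℤ.* S₁ ℤ.+ (ℤ.- + 2 ℤ.* d ℤ.+ + 0)
    other-path i i≢j = ∑ℕ-affine N longWeight _ (+ 0) ((ℤ.- + 2 , suc r) ∷ []) (1+r<N ∷ []) (Δ²-long-to-other-long X r X+r i≢j)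
    collect : ∀ s₀ s₁ a b c d →
              (+ 0 ℤ.* s₀ ℤ.+ (ℤ.-1ℤ ℤ.* a ℤ.+ (ℤ.-1ℤ ℤ.* b ℤ.+ + 0)))
                ℤ.+ ((+ 0 ℤ.* s₁ ℤ.+ (+ 2 ℤ.* c ℤ.+ + 0)) ℤ.+ + 2 ℤ.* (+ 0 ℤ.* s₁ ℤ.+ (ℤ.- + 2 ℤ.* d ℤ.+ + 0)))
                              ≡ ℤ.- (a ℤ.+ b) ℤ.+ + 2 ℤ.* c ℤ.- + 4 ℤ.* d
    collect = solve-∀

  column-Δ-short : Δ (λ Y → column (short , Y)) 0 ≡ ℤ.- S₀ ℤ.+ + 2 ℤ.* shortWeight 0 ℤ.+ + 3 ℤ.* (S₁ ℤ.- longWeight M)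
  column-Δ-short = begin
    Δ (λ Y → column (short , Y)) 0
      ≡⟨ vertexSum-Δ (λ v Y → + dist v (short , Y)) 0 ⟩
    vertexSum (λ v → weight v ℤ.* Δ (λ Y → + dist v (short , Y)) 0)
      ≡⟨ cong₂ ℤ._+_ (∑ℕ-affine (suc N) shortWeight (λ t → Δ (λ Y → + dist (short , t) (short , Y)) 0) ℤ.-1ℤ
                                  ((+ 2 , 0) ∷ []) (s≤s z≤n ∷ []) (λ t _ → Δ-same short t))
                     (sum-cong-≗ (λ i → ∑ℕ-affine N longWeight (λ t → Δ (λ Y → + dist (long i , suc t) (short , Y)) 0) (+ 1)
                                                    ((ℤ.-1ℤ , M) ∷ []) (ℕP.≤-refl ∷ []) (Δ-long-to-short i))) ⟩
    (ℤ.-1ℤ ℤ.* S₀ ℤ.+ (+ 2 ℤ.* a ℤ.+ + 0)) ℤ.+ (T ℤ.+ (T ℤ.+ (T ℤ.+ + 0)))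
      ≡⟨ collect S₀ S₁ a b ⟩
    ℤ.- S₀ ℤ.+ + 2 ℤ.* a ℤ.+ + 3 ℤ.* (S₁ ℤ.- b) ∎
    where
    open ≡-Reasoning
    a = shortWeight 0
    b = longWeight M
    T = + 1 ℤ.* S₁ ℤ.+ (ℤ.-1ℤ ℤ.* b ℤ.+ + 0)
    collect : ∀ s₀ s₁ a b → let T = + 1 ℤ.* s₁ ℤ.+ (ℤ.-1ℤ ℤ.* b ℤ.+ + 0) in
              (ℤ.-1ℤ ℤ.* s₀ ℤ.+ (+ 2 ℤ.* a ℤ.+ + 0)) ℤ.+ (T ℤ.+ (T ℤ.+ (T ℤ.+ + 0))) ≡ ℤ.- s₀ ℤ.+ + 2 ℤ.* a ℤ.+ + 3 ℤ.* (s₁ ℤ.- b)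
    collect = solve-∀

  column-Δ-long : ∀ j → Δ (λ Y → column (long j , Y)) 0 ≡ S₀ ℤ.- shortWeight N ℤ.+ S₁
  column-Δ-long j = begin
    Δ (λ Y → column (long j , Y)) 0
      ≡⟨ vertexSum-Δ (λ v Y → + dist v (long j , Y)) 0 ⟩
    vertexSum (λ v → weight v ℤ.* Δ (λ Y → + dist v (long j , Y)) 0)
      ≡⟨ cong₂ ℤ._+_ (∑ℕ-affine (suc N) shortWeight (λ t → Δ (λ Y → + dist (short , t) (long j , Y)) 0) (+ 1)
                                  ((ℤ.-1ℤ , N) ∷ []) (ℕP.≤-refl ∷ []) (Δ-short-to-long j))
                     (∑-Fin3-one-two j _ same-path other-path) ⟩
    (+ 1 ℤ.* S₀ ℤ.+ (ℤ.-1ℤ ℤ.* a ℤ.+ + 0)) ℤ.+ ((ℤ.-1ℤ ℤ.* S₁ ℤ.+ + 0) ℤ.+ + 2 ℤ.* (+ 1 ℤ.* S₁ ℤ.+ + 0))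
      ≡⟨ collect S₀ S₁ a ⟩
    S₀ ℤ.- a ℤ.+ S₁ ∎
    where
    open ≡-Reasoning
    a = shortWeight N
    same-path : ∑ℕ N (λ t → longWeight t ℤ.* Δ (λ Y → + dist (long j , suc t) (long j , Y)) 0) ≡ ℤ.-1ℤ ℤ.* S₁ ℤ.+ + 0
    same-path = ∑ℕ-affine N longWeight _ ℤ.-1ℤ [] [] (λ t _ → Δ-same (long j) (suc t))
    other-path : ∀ i → i ≢ j → ∑ℕ N (λ t → longWeight t ℤ.* Δ (λ Y → + dist (long i , suc t) (long j , Y)) 0) ≡ + 1 ℤ.* S₁ ℤ.+ + 0
    other-path i i≢j = ∑ℕ-affine N longWeight _ (+ 1) [] [] (Δ-long-to-other-long i≢j)
    collect : ∀ s₀ s₁ a → (+ 1 ℤ.* s₀ ℤ.+ (ℤ.-1ℤ ℤ.* a ℤ.+ + 0)) ℤ.+ ((ℤ.-1ℤ ℤ.* s₁ ℤ.+ + 0) ℤ.+ + 2 ℤ.* (+ 1 ℤ.* s₁ ℤ.+ + 0))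
                          ≡ s₀ ℤ.- a ℤ.+ s₁
    collect = solve-∀

  g : ℤ
  g = ∑ℕ N (ω ℤ.^_)

  S₀≡ : S₀ ≡ + 2 ℤ.* (+ 1 ℤ.+ ω ℤ.* g)
  S₀≡ = begin
    ∑ℕ (suc N) (λ t → ω ℤ.^ (N ∸ t) ℤ.+ ω ℤ.^ t)
      ≡⟨ ∑ℕ-+ (suc N) (λ t → ω ℤ.^ (N ∸ t)) (ω ℤ.^_) ⟩
    ∑ℕ (suc N) (λ t → ω ℤ.^ (N ∸ t)) ℤ.+ G
      ≡⟨ cong (ℤ._+ G) (∑ℕ-reverse N (ω ℤ.^_)) ⟩
    G ℤ.+ G
      ≡⟨ cong (λ s → (+ 1 ℤ.+ s) ℤ.+ (+ 1 ℤ.+ s)) (∑ℕ-* N ω (ω ℤ.^_)) ⟩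
    (+ 1 ℤ.+ ω ℤ.* g) ℤ.+ (+ 1 ℤ.+ ω ℤ.* g)
      ≡⟨ double (+ 1 ℤ.+ ω ℤ.* g) ⟩
    + 2 ℤ.* (+ 1 ℤ.+ ω ℤ.* g) ∎
    where
    open ≡-Reasoning
    G = ∑ℕ (suc N) (ω ℤ.^_)
    double : ∀ x → x ℤ.+ x ≡ + 2 ℤ.* x
    double = solve-∀

  S₁≡ : S₁ ≡ + 2 ℤ.* g
  S₁≡ = begin
    ∑ℕ N (λ t → ω ℤ.^ (M ∸ t) ℤ.+ ω ℤ.^ t)            ≡⟨ ∑ℕ-+ N (λ t → ω ℤ.^ (M ∸ t)) (ω ℤ.^_) ⟩
    ∑ℕ N (λ t → ω ℤ.^ (M ∸ t)) ℤ.+ g                  ≡⟨ cong (ℤ._+ g) (∑ℕ-reverse M (ω ℤ.^_)) ⟩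
    g ℤ.+ g                                           ≡⟨ double g ⟩
    + 2 ℤ.* g                                         ∎
    where
    open ≡-Reasoning
    double : ∀ x → x ℤ.+ x ≡ + 2 ℤ.* x
    double = solve-∀

  total-weight : vertexSum weight ≡ + 2
  total-weight = begin
    S₀ ℤ.+ (S₁ ℤ.+ (S₁ ℤ.+ (S₁ ℤ.+ + 0)))             ≡⟨ cong₂ (λ a b → a ℤ.+ (b ℤ.+ (b ℤ.+ (b ℤ.+ + 0)))) S₀≡ S₁≡ ⟩
    + 2 ℤ.* (+ 1 ℤ.+ ω ℤ.* g) ℤ.+ (+ 2 ℤ.* g ℤ.+ (+ 2 ℤ.* g ℤ.+ (+ 2 ℤ.* g ℤ.+ + 0)))
                                                       ≡⟨ cancel g ⟩
    + 2                                               ∎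
    where
    open ≡-Reasoning
    cancel : ∀ g → + 2 ℤ.* (+ 1 ℤ.+ ω ℤ.* g) ℤ.+ (+ 2 ℤ.* g ℤ.+ (+ 2 ℤ.* g ℤ.+ (+ 2 ℤ.* g ℤ.+ + 0))) ≡ + 2
    cancel = solve-∀

  private
    ∸-from : ∀ {a b c} → a + b ≡ c → c ∸ a ≡ b
    ∸-from {a} {b} a+b≡c = trans (cong (_∸ a) (sym a+b≡c)) (ℕP.m+n∸m≡n a b)

  module _ (X r : ℕ) (X+r : 2 + X + r ≡ N) where

    private
      P R : ℤ
      P = ω ℤ.^ X
      R = ω ℤ.^ r
      M≡ : suc X + r ≡ M
      M≡ = ℕP.suc-injective X+r
      N∸1+X : N ∸ suc X ≡ suc r
      N∸1+X = ∸-from {suc X} (trans (ℕP.+-suc (suc X) r) X+r)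
      N∸1+r : N ∸ suc r ≡ suc X
      N∸1+r = ∸-from {suc r} (trans (cong suc (trans (ℕP.+-suc r X) (cong suc (ℕP.+-comm r X)))) X+r)
      N∸2+r : N ∸ suc (suc r) ≡ X
      N∸2+r = ∸-from {suc (suc r)} (trans (cong (λ z → suc (suc z)) (ℕP.+-comm r X)) X+r)
      M∸r : M ∸ r ≡ suc X
      M∸r = ∸-from {r} (trans (ℕP.+-comm r (suc X)) M≡)
      M∸1+r : M ∸ suc r ≡ X
      M∸1+r = ∸-from {suc r} (trans (cong suc (ℕP.+-comm r X)) M≡)
      M∸X : M ∸ X ≡ suc r
      M∸X = ∸-from {X} (trans (ℕP.+-suc X r) M≡)

    column-Δ²-short≡0 : Δ² (λ Y → column (short , Y)) X ≡ + 0
    column-Δ²-short≡0 = begin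
      Δ² (λ Y → column (short , Y)) X
        ≡⟨ column-Δ²-short X+r ⟩
      + 2 ℤ.* shortWeight (suc X) ℤ.- + 3 ℤ.* (longWeight r ℤ.+ longWeight (suc r))
        ≡⟨ cong₂ (λ a b → + 2 ℤ.* a ℤ.- + 3 ℤ.* b)
                 (cong (λ e → ω ℤ.^ e ℤ.+ ω ℤ.* P) N∸1+X)
                 (cong₂ (λ e e′ → (ω ℤ.^ e ℤ.+ R) ℤ.+ (ω ℤ.^ e′ ℤ.+ ω ℤ.* R)) M∸r M∸1+r) ⟩
      + 2 ℤ.* (ω ℤ.* R ℤ.+ ω ℤ.* P) ℤ.- + 3 ℤ.* ((ω ℤ.* P ℤ.+ R) ℤ.+ (P ℤ.+ ω ℤ.* R))
        ≡⟨ cancel P R ⟩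
      + 0 ∎
      where
      open ≡-Reasoning
      cancel : ∀ P R → + 2 ℤ.* (ω ℤ.* R ℤ.+ ω ℤ.* P) ℤ.- + 3 ℤ.* ((ω ℤ.* P ℤ.+ R) ℤ.+ (P ℤ.+ ω ℤ.* R)) ≡ + 0
      cancel = solve-∀

    column-Δ²-long≡0 : ∀ j → Δ² (λ Y → column (long j , Y)) X ≡ + 0
    column-Δ²-long≡0 j = begin
      Δ² (λ Y → column (long j , Y)) X
        ≡⟨ column-Δ²-long j X+r ⟩
      ℤ.- (shortWeight (suc r) ℤ.+ shortWeight (suc (suc r))) ℤ.+ + 2 ℤ.* longWeight X ℤ.- + 4 ℤ.* longWeight (suc r)
        ≡⟨ cong₂ (λ (e₁ , e₂) (e₃ , e₄) → ℤ.- ((ω ℤ.^ e₁ ℤ.+ ω ℤ.* R) ℤ.+ (ω ℤ.^ e₂ ℤ.+ ω ℤ.* (ω ℤ.* R)))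
                                             ℤ.+ + 2 ℤ.* (ω ℤ.^ e₃ ℤ.+ P) ℤ.- + 4 ℤ.* (ω ℤ.^ e₄ ℤ.+ ω ℤ.* R))
                 (cong₂ _,_ N∸1+r N∸2+r) (cong₂ _,_ M∸X M∸1+r) ⟩
      ℤ.- ((ω ℤ.* P ℤ.+ ω ℤ.* R) ℤ.+ (P ℤ.+ ω ℤ.* (ω ℤ.* R))) ℤ.+ + 2 ℤ.* (ω ℤ.* R ℤ.+ P) ℤ.- + 4 ℤ.* (P ℤ.+ ω ℤ.* R)
        ≡⟨ cancel P R ⟩
      + 0 ∎
      where
      open ≡-Reasoning
      cancel : ∀ P R → ℤ.- ((ω ℤ.* P ℤ.+ ω ℤ.* R) ℤ.+ (P ℤ.+ ω ℤ.* (ω ℤ.* R))) ℤ.+ + 2 ℤ.* (ω ℤ.* R ℤ.+ P) ℤ.- + 4 ℤ.* (P ℤ.+ ω ℤ.* R) ≡ + 0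
      cancel = solve-∀

  column-Δ-short≡0 : Δ (λ Y → column (short , Y)) 0 ≡ + 0
  column-Δ-short≡0 = begin
    Δ (λ Y → column (short , Y)) 0
      ≡⟨ column-Δ-short ⟩
    ℤ.- S₀ ℤ.+ + 2 ℤ.* shortWeight 0 ℤ.+ + 3 ℤ.* (S₁ ℤ.- longWeight M)
      ≡⟨ cong₂ (λ (s₀ , s₁) e → ℤ.- s₀ ℤ.+ + 2 ℤ.* shortWeight 0 ℤ.+ + 3 ℤ.* (s₁ ℤ.- (ω ℤ.^ e ℤ.+ Q)))
               (cong₂ _,_ S₀≡ S₁≡) (ℕP.n∸n≡0 M) ⟩
    ℤ.- (+ 2 ℤ.* (+ 1 ℤ.+ ω ℤ.* g)) ℤ.+ + 2 ℤ.* (ω ℤ.* Q ℤ.+ + 1) ℤ.+ + 3 ℤ.* (+ 2 ℤ.* g ℤ.- (+ 1 ℤ.+ Q))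
      ≡⟨ regroup g Q ⟩
    + 3 ℤ.* (+ 4 ℤ.* g ℤ.+ ω ℤ.* Q) ℤ.- + 3
      ≡⟨ cong (λ z → + 3 ℤ.* z ℤ.- + 3) (∑ℕ-geometric ω N) ⟩
    + 0 ∎
    where
    open ≡-Reasoning
    Q = ω ℤ.^ M
    regroup : ∀ g Q → ℤ.- (+ 2 ℤ.* (+ 1 ℤ.+ ω ℤ.* g)) ℤ.+ + 2 ℤ.* (ω ℤ.* Q ℤ.+ + 1) ℤ.+ + 3 ℤ.* (+ 2 ℤ.* g ℤ.- (+ 1 ℤ.+ Q))
                    ≡ + 3 ℤ.* (+ 4 ℤ.* g ℤ.+ ω ℤ.* Q) ℤ.- + 3
    regroup = solve-∀

  column-Δ-long≡0 : ∀ j → Δ (λ Y → column (long j , Y)) 0 ≡ + 0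
  column-Δ-long≡0 j = begin
    Δ (λ Y → column (long j , Y)) 0
      ≡⟨ column-Δ-long j ⟩
    S₀ ℤ.- shortWeight N ℤ.+ S₁
      ≡⟨ cong₂ (λ (s₀ , s₁) e → s₀ ℤ.- (ω ℤ.^ e ℤ.+ ω ℤ.^ N) ℤ.+ s₁) (cong₂ _,_ S₀≡ S₁≡) (ℕP.n∸n≡0 N) ⟩
    + 2 ℤ.* (+ 1 ℤ.+ ω ℤ.* g) ℤ.- (+ 1 ℤ.+ ω ℤ.^ N) ℤ.+ + 2 ℤ.* g
      ≡⟨ regroup g (ω ℤ.^ N) ⟩
    + 1 ℤ.- (+ 4 ℤ.* g ℤ.+ ω ℤ.^ N)
      ≡⟨ cong (ℤ._-_ (+ 1)) (∑ℕ-geometric ω N) ⟩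
    + 0 ∎
    where
    open ≡-Reasoning
    regroup : ∀ g p → + 2 ℤ.* (+ 1 ℤ.+ ω ℤ.* g) ℤ.- (+ 1 ℤ.+ p) ℤ.+ + 2 ℤ.* g ≡ + 1 ℤ.- (+ 4 ℤ.* g ℤ.+ p)
    regroup = solve-∀

  column-hub₀ : ∀ q → column (q , 0) ≡ column (short , 0)
  column-hub₀ q = vertexSum-cong (λ v v-canonical → cong (λ d → weight v ℤ.* + d)
    (trans (dist-comm v (q , 0)) (trans (dist-from-hub₀ q v-canonical) (sym (trans (dist-comm v (short , 0)) (dist-from-hub₀ short v-canonical))))))

  column-constant : ∀ q {X} → X ≤ N → column (q , X) ≡ column (short , 0)
  column-constant q {X} X≤N = trans (Δ-vanishing⇒constant N (λ Y → column (q , Y)) (Δ-zero q) (Δ²-zero q) X X≤N) (column-hub₀ q)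
    where
    Δ-zero : ∀ q → Δ (λ Y → column (q , Y)) 0 ≡ + 0
    Δ-zero short    = column-Δ-short≡0
    Δ-zero (long j) = column-Δ-long≡0 j
    Δ²-zero : ∀ q x → 2 + x ≤ N → Δ² (λ Y → column (q , Y)) x ≡ + 0
    Δ²-zero q x 2+x≤N with ℕP.m≤n⇒∃[o]m+o≡n 2+x≤N | q
    ... | r , x+r | short  = column-Δ²-short≡0 x r x+r
    ... | r , x+r | long j = column-Δ²-long≡0 x r x+r j

  column-hubs : column (short , 0) ℤ.+ column (short , N) ≡ vertexSum (λ v → weight v ℤ.* + len (proj₁ v))
  column-hubs = trans (sym (vertexSum-+ (λ v → weight v ℤ.* + dist v (short , 0)) (λ v → weight v ℤ.* + dist v (short , N))))
                 (vertexSum-cong (λ v v-canonical → trans (sym (ℤP.*-distribˡ-+ (weight v) (+ dist v (short , 0)) (+ dist v (short , N))))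
                                                          (cong (ℤ._*_ (weight v)) (hub-distances v v-canonical))))
    where
    hub-distances : ∀ v → Canonical v → + dist v (short , 0) ℤ.+ + dist v (short , N) ≡ + len (proj₁ v)
    hub-distances v v-canonical = begin
      + dist v (short , 0) ℤ.+ + dist v (short , N)
        ≡⟨ cong₂ (λ a b → + a ℤ.+ + b) (trans (dist-comm v (short , 0)) (dist-from-hub₀ short v-canonical))
                                         (trans (dist-comm v (short , N)) (dist-from-hub₁ short v-canonical)) ⟩
      + (proj₂ v + (len (proj₁ v) ∸ proj₂ v))
        ≡⟨ cong +_ (ℕP.m+[n∸m]≡n (canonical-≤len v-canonical)) ⟩
      + len (proj₁ v) ∎
      where open ≡-Reasoning

  column-value : column (short , 0) ≡ + N ℤ.+ + 3 ℤ.* g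
  column-value = ℤP.*-cancelˡ-≡ (+ 2) _ _ (begin
    + 2 ℤ.* column (short , 0)
      ≡⟨ double (column (short , 0)) ⟩
    column (short , 0) ℤ.+ column (short , 0)
      ≡⟨ cong (ℤ._+_ (column (short , 0))) (sym (column-constant short ℕP.≤-refl)) ⟩
    column (short , 0) ℤ.+ column (short , N)
      ≡⟨ column-hubs ⟩
    vertexSum (λ v → weight v ℤ.* + len (proj₁ v))
      ≡⟨ cong₂ ℤ._+_ (∑ℕ-affine (suc N) shortWeight (λ _ → + N) (+ N) [] [] (λ t _ → sym (ℤP.+-identityʳ (+ N))))
                     (sum-cong-≗ {3} (λ i → ∑ℕ-affine N longWeight (λ _ → + suc N) (+ suc N) [] [] (λ t _ → sym (ℤP.+-identityʳ (+ suc N))))) ⟩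
    (+ N ℤ.* S₀ ℤ.+ + 0) ℤ.+ (T ℤ.+ (T ℤ.+ (T ℤ.+ + 0)))
      ≡⟨ cong₂ (λ s₀ s₁ → let T = + suc N ℤ.* s₁ ℤ.+ + 0 in (+ N ℤ.* s₀ ℤ.+ + 0) ℤ.+ (T ℤ.+ (T ℤ.+ (T ℤ.+ + 0)))) S₀≡ S₁≡ ⟩
    (+ N ℤ.* (+ 2 ℤ.* (+ 1 ℤ.+ ω ℤ.* g)) ℤ.+ + 0) ℤ.+ (T′ ℤ.+ (T′ ℤ.+ (T′ ℤ.+ + 0)))
      ≡⟨ collect (+ N) g ⟩
    + 2 ℤ.* (+ N ℤ.+ + 3 ℤ.* g) ∎)
    where
    open ≡-Reasoning
    T  = + suc N ℤ.* S₁ ℤ.+ + 0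
    T′ = + suc N ℤ.* (+ 2 ℤ.* g) ℤ.+ + 0
    double : ∀ x → + 2 ℤ.* x ≡ x ℤ.+ x
    double = solve-∀
    collect : ∀ n g → let T = (+ 1 ℤ.+ n) ℤ.* (+ 2 ℤ.* g) ℤ.+ + 0 in
              (n ℤ.* (+ 2 ℤ.* (+ 1 ℤ.+ ω ℤ.* g)) ℤ.+ + 0) ℤ.+ (T ℤ.+ (T ℤ.+ (T ℤ.+ + 0))) ≡ + 2 ℤ.* (n ℤ.+ + 3 ℤ.* g)
    collect = solve-∀

  basket-certificate : Certificate (Basket k) (+ N ℤ.+ + 3 ℤ.* g)
  basket-certificate = record
    { weight     = λ a → weight (decode (toℕ a))
    ; weight-sum = trans (∑-vertices weight) total-weight
    ; column-sum = columns
    }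
    where
    columns : ∀ {D′} → IsDistanceMatrix (Basket k) D′ → ∀ c → ∑[ a < n ] (weight (decode (toℕ a)) ℤ.* + D′ a c) ≡ + N ℤ.+ + 3 ℤ.* g
    columns {D′} isD′ c = begin
      ∑[ a < n ] (weight (decode (toℕ a)) ℤ.* + D′ a c)
        ≡⟨ sum-cong-≗ (λ a → cong (λ d → weight (decode (toℕ a)) ℤ.* + d) (IsDistance-unique (isD′ a c) (D-isDistanceMatrix a c))) ⟩
      ∑[ a < n ] (weight (decode (toℕ a)) ℤ.* + dist (decode (toℕ a)) (decode (toℕ c)))
        ≡⟨ ∑-vertices (λ v → weight v ℤ.* + dist v (decode (toℕ c))) ⟩
      column (decode (toℕ c))
        ≡⟨ column-constant (proj₁ (decode (toℕ c))) (proj₁ (decode-canonical c)) ⟩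
      column (short , 0)
        ≡⟨ column-value ⟩
      + N ℤ.+ + 3 ℤ.* g ∎
      where open ≡-Reasoning

-- The value s

-[m*n]/n≡-m : ∀ m d → ℤ.- + (m * suc d) ℤ./ + suc d ≡ ℤ.- + m
-[m*n]/n≡-m zero    d = refl
-[m*n]/n≡-m (suc m) d = trans (ℤP.*-identityˡ _) divide
  where
  divide : -[1+ d + m * suc d ] ℤ./ℕ suc d ≡ ℤ.- + suc m
  divide with suc (d + m * suc d) ℕ.% suc d in rem
  ... | zero  = cong (λ q → ℤ.- + q) (ℕD.m*n/n≡m (suc m) (suc d))
  ... | suc _ with () ← trans (sym rem) (ℕD.m*n%n≡0 (suc m) (suc d))

-- |sVal j|, characterised by 8 σ + 8 j + 3 = 3 · 9^j.
σ : ℕ → ℕ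
σ zero    = 0
σ (suc j) = 9 * σ j + 8 * j + 2

σ-spec : ∀ j → + 8 ℤ.* + σ j ℤ.+ + 8 ℤ.* + j ℤ.+ + 3 ≡ + 3 ℤ.* ω ℤ.^ (2 * j)
σ-spec zero    = refl
σ-spec (suc j) = begin
  + 8 ℤ.* + σ (suc j) ℤ.+ + 8 ℤ.* + suc j ℤ.+ + 3
    ≡⟨ cong (λ s → + 8 ℤ.* s ℤ.+ + 8 ℤ.* + suc j ℤ.+ + 3) σ-suc ⟩
  + 8 ℤ.* (+ 9 ℤ.* + σ j ℤ.+ + 8 ℤ.* + j ℤ.+ + 2) ℤ.+ + 8 ℤ.* (+ 1 ℤ.+ + j) ℤ.+ + 3
    ≡⟨ unfold (+ σ j) (+ j) ⟩
  + 9 ℤ.* (+ 8 ℤ.* + σ j ℤ.+ + 8 ℤ.* + j ℤ.+ + 3)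
    ≡⟨ cong (ℤ._*_ (+ 9)) (σ-spec j) ⟩
  + 9 ℤ.* (+ 3 ℤ.* ω ℤ.^ (2 * j))
    ≡⟨ square (ω ℤ.^ (2 * j)) ⟩
  + 3 ℤ.* ω ℤ.^ (2 + 2 * j)
    ≡⟨ cong (λ e → + 3 ℤ.* ω ℤ.^ e) (sym (ℕP.*-suc 2 j)) ⟩
  + 3 ℤ.* ω ℤ.^ (2 * suc j) ∎
  where
  open ≡-Reasoning
  σ-suc : + σ (suc j) ≡ + 9 ℤ.* + σ j ℤ.+ + 8 ℤ.* + j ℤ.+ + 2
  σ-suc = trans (ℤP.pos-+ (9 * σ j + 8 * j) 2) (cong (ℤ._+ + 2) (trans (ℤP.pos-+ (9 * σ j) (8 * j)) (cong₂ ℤ._+_ (ℤP.pos-* 9 (σ j)) (ℤP.pos-* 8 j))))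
  unfold : ∀ s j → + 8 ℤ.* (+ 9 ℤ.* s ℤ.+ + 8 ℤ.* j ℤ.+ + 2) ℤ.+ + 8 ℤ.* (+ 1 ℤ.+ j) ℤ.+ + 3 ≡ + 9 ℤ.* (+ 8 ℤ.* s ℤ.+ + 8 ℤ.* j ℤ.+ + 3)
  unfold = solve-∀
  square : ∀ p → + 9 ℤ.* (+ 3 ℤ.* p) ≡ + 3 ℤ.* (ω ℤ.* (ω ℤ.* p))
  square = solve-∀

sVal≡-σ : ∀ j → sVal j ≡ ℤ.- + σ j
sVal≡-σ j = begin
  (ω ℤ.^ (2 * j + 1) ℤ.+ + (4 * (2 * j + 1)) ℤ.- + 1) ℤ./ + 8
    ≡⟨ cong (ℤ._/ + 8) numerator ⟩
  ℤ.- + (σ j * 8) ℤ./ + 8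
    ≡⟨ -[m*n]/n≡-m (σ j) 7 ⟩
  ℤ.- + σ j ∎
  where
  open ≡-Reasoning
  numerator : ω ℤ.^ (2 * j + 1) ℤ.+ + (4 * (2 * j + 1)) ℤ.- + 1 ≡ ℤ.- + (σ j * 8)
  numerator = begin
    ω ℤ.^ (2 * j + 1) ℤ.+ + (4 * (2 * j + 1)) ℤ.- + 1
      ≡⟨ cong₂ (λ p q → p ℤ.+ q ℤ.- + 1) (cong (ω ℤ.^_) (ℕP.+-comm (2 * j) 1))
               (trans (ℤP.pos-* 4 (2 * j + 1)) (cong (ℤ._*_ (+ 4)) (trans (ℤP.pos-+ (2 * j) 1) (cong (ℤ._+ + 1) (ℤP.pos-* 2 j))))) ⟩
    ω ℤ.* ω ℤ.^ (2 * j) ℤ.+ + 4 ℤ.* (+ 2 ℤ.* + j ℤ.+ + 1) ℤ.- + 1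
      ≡⟨ regroup (ω ℤ.^ (2 * j)) (+ j) ⟩
    + 8 ℤ.* + j ℤ.+ + 3 ℤ.- + 3 ℤ.* ω ℤ.^ (2 * j)
      ≡⟨ cong (λ p → + 8 ℤ.* + j ℤ.+ + 3 ℤ.- p) (sym (σ-spec j)) ⟩
    + 8 ℤ.* + j ℤ.+ + 3 ℤ.- (+ 8 ℤ.* + σ j ℤ.+ + 8 ℤ.* + j ℤ.+ + 3)
      ≡⟨ cancel (+ σ j) (+ j) ⟩
    ℤ.- (+ σ j ℤ.* + 8)
      ≡⟨ cong ℤ.-_ (sym (ℤP.pos-* (σ j) 8)) ⟩
    ℤ.- + (σ j * 8) ∎
    where
    regroup : ∀ p j → ω ℤ.* p ℤ.+ + 4 ℤ.* (+ 2 ℤ.* j ℤ.+ + 1) ℤ.- + 1 ≡ + 8 ℤ.* j ℤ.+ + 3 ℤ.- + 3 ℤ.* p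
    regroup = solve-∀
    cancel : ∀ s j → + 8 ℤ.* j ℤ.+ + 3 ℤ.- (+ 8 ℤ.* s ℤ.+ + 8 ℤ.* j ℤ.+ + 3) ≡ ℤ.- (s ℤ.* + 8)
    cancel = solve-∀

basket-value≡2sVal : ∀ j → + (2 * j) ℤ.+ + 3 ℤ.* ∑ℕ (2 * j) (ω ℤ.^_) ≡ + 2 ℤ.* sVal j
basket-value≡2sVal j = ℤP.*-cancelˡ-≡ (+ 4) _ _ (begin
  + 4 ℤ.* (+ (2 * j) ℤ.+ + 3 ℤ.* g)
    ≡⟨ cong (λ n → + 4 ℤ.* (n ℤ.+ + 3 ℤ.* g)) (ℤP.pos-* 2 j) ⟩
  + 4 ℤ.* (+ 2 ℤ.* + j ℤ.+ + 3 ℤ.* g)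
    ≡⟨ regroup (+ j) g p ⟩
  + 8 ℤ.* + j ℤ.+ + 3 ℤ.* (+ 4 ℤ.* g ℤ.+ p) ℤ.- + 3 ℤ.* p
    ≡⟨ cong₂ (λ a b → + 8 ℤ.* + j ℤ.+ + 3 ℤ.* a ℤ.- b) (∑ℕ-geometric ω (2 * j)) (sym (σ-spec j)) ⟩
  + 8 ℤ.* + j ℤ.+ + 3 ℤ.* + 1 ℤ.- (+ 8 ℤ.* + σ j ℤ.+ + 8 ℤ.* + j ℤ.+ + 3)
    ≡⟨ cancel (+ σ j) (+ j) ⟩
  + 4 ℤ.* (+ 2 ℤ.* ℤ.- + σ j)
    ≡⟨ cong (λ s → + 4 ℤ.* (+ 2 ℤ.* s)) (sym (sVal≡-σ j)) ⟩
  + 4 ℤ.* (+ 2 ℤ.* sVal j) ∎)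
  where
  open ≡-Reasoning
  g = ∑ℕ (2 * j) (ω ℤ.^_)
  p = ω ℤ.^ (2 * j)
  regroup : ∀ j g p → + 4 ℤ.* (+ 2 ℤ.* j ℤ.+ + 3 ℤ.* g) ≡ + 8 ℤ.* j ℤ.+ + 3 ℤ.* (+ 4 ℤ.* g ℤ.+ p) ℤ.- + 3 ℤ.* p
  regroup = solve-∀
  cancel : ∀ s j → + 8 ℤ.* j ℤ.+ + 3 ℤ.* + 1 ℤ.- (+ 8 ℤ.* s ℤ.+ + 8 ℤ.* j ℤ.+ + 3) ≡ + 4 ℤ.* (+ 2 ℤ.* ℤ.- s)
  cancel = solve-∀

odd-basket-certificate : ∀ j → 1 ≤ j → Certificate (Basket (2 * j + 1)) (+ 2 ℤ.* sVal j)
-- suc (j + suc (j + 0)) is 2 * suc j by definition.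
odd-basket-certificate (suc j) _ =
  subst₂ (λ k a → Certificate (Basket k) a) (ℕP.+-comm 1 (2 * suc j)) (basket-value≡2sVal (suc j))
         (BasketWeights.basket-certificate (j + suc (j + 0)))

2s+2∣s∣≡0 : ∀ j → + 2 ℤ.* sVal j ℤ.+ + (2 * ∣ sVal j ∣) ≡ + 0
2s+2∣s∣≡0 j = begin
  + 2 ℤ.* sVal j ℤ.+ + (2 * ∣ sVal j ∣)          ≡⟨ cong (λ s → + 2 ℤ.* s ℤ.+ + (2 * ∣ s ∣)) (sVal≡-σ j) ⟩
  + 2 ℤ.* ℤ.- + σ j ℤ.+ + (2 * ∣ ℤ.- + σ j ∣)    ≡⟨ cong (λ m → + 2 ℤ.* ℤ.- + σ j ℤ.+ + (2 * m)) (ℤP.∣-i∣≡∣i∣ (+ σ j)) ⟩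
  + 2 ℤ.* ℤ.- + σ j ℤ.+ + (2 * σ j)              ≡⟨ cong (ℤ._+_ (+ 2 ℤ.* ℤ.- + σ j)) (ℤP.pos-* 2 (σ j)) ⟩
  + 2 ℤ.* ℤ.- + σ j ℤ.+ + 2 ℤ.* + σ j            ≡⟨ cancel (+ σ j) ⟩
  + 0                                            ∎
  where
  open ≡-Reasoning
  cancel : ∀ s → + 2 ℤ.* ℤ.- s ℤ.+ + 2 ℤ.* s ≡ + 0
  cancel = solve-∀

theorem1p3 : (j : ℕ) → 1 ≤ j →
    ∀ {n} {G : Graph n} → Obtained (2 * j + 1) (2 * ∣ sVal j ∣) n G →
    DistanceExceptional G
theorem1p3 j 1≤j G-obtained =
  Certificate⇒DistanceExceptional
    (subst (Certificate _) (2s+2∣s∣≡0 j) (Certificate-obtained (odd-basket-certificate j 1≤j) G-obtained))
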